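{- Let $n\ge 1$ and $h\ge n$ be integers. In the $h$-AO-SP with $n$ online candidates, the algorithm described below (Algorithm 2) is $1/2$-competitive. Algorithm 2: draw a subset $T\subseteq H$ of cardinality $n-1$ uniformly at random; when candidate $c_\ell$ arrives at round $\ell$, if $c_\ell > \max T$ then accept $c_\ell$ and terminate.
   Context: The adversarial-order secretary problem with a sample of size $h$ ($h$-AO-SP), for integers $n\ge 1$, $h\ge 0$: an adversary picks a set $C$ of $n+h$ candidates, each with a value in $\mathbb{R}_{\ge 0}$ (candidates are totally ordered by value, ties broken by a fixed consistent tie-breaker). A subset $H\subseteq C$ of cardinality $h$ (the history set) is drawn uniformly at random and given, together with $n$, to the online player upfront; $O = C\setminus H$ is the online set. The adversary then chooses an order $c_1,\dots,c_n$ of $O$ (which may depend on $H$), and the candidates are revealed one by one; after each arrival the player must irrevocably accept or reject the current candidate, and accepting terminates the process. $\mathrm{ALG}$ denotes the value of the accepted candidate (0 if none) and $\mathrm{OPT}=\max O$. An algorithm is $c$-competitive if for every $C$ and every adversarial ordering strategy $\mathbb{E}[\mathrm{ALG}]\ge c\,\mathbb{E}[\mathrm{OPT}]$, the expectation being over the random choice of $H$ and the algorithm's internal randomness. (The convention $\max\emptyset$ smaller than every value applies when $n=1$.)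
   Formalization: The candidate values are nonnegative rationals rather than elements of $\mathbb{R}_{\ge 0}$. -}

module Defs where

open import Data.Bool using (Bool; true; false; _∧_; _∨_; not; if_then_else_)
open import Data.Nat as ℕ using (ℕ; zero; suc)
open import Data.Fin using (Fin; toℕ)
open import Data.Fin.Subset using (Subset; inside; outside; ∣_∣; _⊆_)
open import Data.Fin.Subset.Properties using (_⊆?_)
open import Data.Vec using (Vec; []; _∷_; lookup)
open import Data.List using (List; []; _∷_; map; filter; filterᵇ; _++_; allFin; foldr; length)
open import Data.Integer using (+_)
open import Data.Rational using (ℚ; 0ℚ; _+_; _*_; _⊔_; _≤ᵇ_; _/_)
open import Relation.Nullary.Decidable using (_×-dec_; ⌊_⌋)
open import Relation.Binary.PropositionalEquality using (_≡_)

allSubsets : (m : ℕ) → List (Subset m)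
allSubsets zero = [] ∷ []
allSubsets (suc m) = map (outside ∷_) (allSubsets m) ++ map (inside ∷_) (allSubsets m)

subsetsOfSize : {m : ℕ} → ℕ → Subset m → List (Subset m)
subsetsOfSize {m} k S = filter (λ T → ∣ T ∣ ℕ.≟ k ×-dec T ⊆? S) (allSubsets m)

members : {m : ℕ} → Subset m → List (Fin m)
members {m} S = filterᵇ (λ i → lookup S i) (allFin m)

compl : {m : ℕ} → Subset m → Subset m
compl [] = []
compl (x ∷ S) = (if x then outside else inside) ∷ compl S

full : (m : ℕ) → Subset m
full zero = []
full (suc m) = inside ∷ full m

-- Strict total order on candidates: by value, ties broken by index.
-- beats v i j  means  candidate i > candidate j.
beats : {m : ℕ} → (Fin m → ℚ) → Fin m → Fin m → Bool
beats v i j = ((v i ≤ᵇ v j) ∧ (v j ≤ᵇ v i) ∧ (toℕ j ℕ.<ᵇ toℕ i))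
              ∨ ((v j ≤ᵇ v i) ∧ not (v i ≤ᵇ v j))

-- c > max T  (max ∅ is below every candidate).
aboveAll : {m : ℕ} → (Fin m → ℚ) → Subset m → Fin m → Bool
aboveAll v T c = foldr (λ t acc → beats v c t ∧ acc) true (members T)

-- Algorithm 2 run on arrival order `order` with sample T:
-- accept the first candidate exceeding max T; value (0 if none).
alg2 : {m : ℕ} → (Fin m → ℚ) → Subset m → List (Fin m) → ℚ
alg2 v T [] = 0ℚ
alg2 v T (c ∷ cs) = if aboveAll v T c then v c else alg2 v T cs

-- Largest value in a list of candidates (values are ≥ 0).
maxVal : {m : ℕ} → (Fin m → ℚ) → List (Fin m) → ℚ
maxVal v = foldr (λ i acc → v i ⊔ acc) 0ℚ

mean : List ℚ → ℚ
mean [] = 0ℚ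
mean (x ∷ xs) = foldr _+_ 0ℚ (x ∷ xs) * ((+ 1) / suc (length xs))

-- E[ALG]: H uniform among h-subsets of C, then T uniform among
-- (n-1)-subsets of H; the adversary's order is σ H.
expALG : (n h : ℕ) → (Fin (n ℕ.+ h) → ℚ) →
         (Subset (n ℕ.+ h) → List (Fin (n ℕ.+ h))) → ℚ
expALG n h v σ =
  mean (map (λ H → mean (map (λ T → alg2 v T (σ H)) (subsetsOfSize (n ℕ.∸ 1) H)))
            (subsetsOfSize h (full (n ℕ.+ h))))

-- E[OPT] with OPT = max O, O = C \ H.
expOPT : (n h : ℕ) → (Fin (n ℕ.+ h) → ℚ) → ℚ
expOPT n h v =
  mean (map (λ H → maxVal v (members (compl H))) (subsetsOfSize h (full (n ℕ.+ h))))

{-# OPTIONS --safe #-}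

-- Write n = k + 1.  Sending a draw (H, T) to (S, T) with S = (C ∖ H) ∪ T is a bijection onto the
-- pairs of a (2k+1)-set S of candidates and a k-subset T ⊆ S, the online set being O = S ∖ T; so it
-- suffices to compare, for each fixed S, the sums of ALG and OPT over all k-subsets T of S.  Whatever
-- the arrival order, Algorithm 2 accepts an element of O above max T, hence earns at least the value
-- of the lowest such element, while OPT is the value of the top element of O.  Let s₁ > s₂ > … be
-- the elements of S.  The samples containing s₁, …, s_{j-1} but not s_j have OPT ≤ v(s_j), and there
-- are C(2k-j+1, k-j+1) of them; the samples inside S ∖ {s₁, …, s_j} containing s_{j+1} earn at least
-- v(s_j), and there are C(2k-j, k-1) of them.  Since C(2k-j+1, k-j+1) ≤ 2 C(2k-j, k-1), peeling off
-- s₁, s₂, … one at a time yields ½ ∑ OPT ≤ ∑ ALG; at the last step, j = k + 1, the single sample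
-- S ∖ {s₁, …, s_{k+1}} pays for the single sample {s₁, …, s_k}.

module Submission where

open import Defs
open import Data.Nat using (ℕ; _+_)
open import Data.Fin using (Fin)
open import Data.Fin.Subset using (Subset; ∣_∣)
open import Data.List using (List)
open import Data.Integer using (+_)
open import Data.Rational using (ℚ; 0ℚ; _≤_; _*_; _/_)
open import Data.List.Relation.Binary.Permutation.Propositional using (_↭_)
open import Relation.Binary.PropositionalEquality using (_≡_)

open import Algebra.Bundles using (CommutativeMonoid; CommutativeRing)
open import Data.Bool using (Bool; true; false; if_then_else_; _∧_; _xor_) renaming (T to True)
open import Data.Bool.Properties using (T-≡; T-∧)
open import Data.Empty using (⊥-elim)
open import Data.Fin using (zero; suc; toℕ)
import Data.Fin.Properties as Fin
open import Data.Fin.Subset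
  using (inside; outside; _∈_; _∉_; _⊆_; ⊥; ⁅_⁆; _∪_; _─_; _-_; Nonempty)
open import Data.Fin.Subset.Properties
  using (_∈?_; _⊆?_; drop-∷-⊆; ⊥⊆; ∉⊥; ∣⊥∣≡0; ∣⁅x⁆∣≡1; x∈⁅x⁆; x∈⁅y⁆⇒x≡y; x∈p∪q⁻; x∈p∪q⁺;
         ∪-identityˡ; ∪-identityʳ; p─q⊆p; p─⊥≡p; p─q─r≡p─q∪r; x∈p∧x∉q⇒x∈p─q; x∈p∧x≢y⇒x∈p-y;
         p⊆q⇒∣p∣≤∣q∣; x∈p⇒∣p-x∣<∣p∣)
import Data.Integer as ℤ
import Data.Integer.Properties as ℤ
open import Data.List using ([]; _∷_; _++_; map; filter; foldr; length; allFin)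
import Data.List.Properties as List
open import Data.List.Membership.Propositional using () renaming (_∈_ to _∈ˡ_)
open import Data.List.Membership.Propositional.Properties using (∈-filter⁺; ∈-filter⁻; ∈-allFin)
open import Data.List.Relation.Binary.Permutation.Propositional using (↭-sym)
open import Data.List.Relation.Binary.Permutation.Propositional.Properties using (∈-resp-↭)
open import Data.List.Relation.Unary.All using (universal)
open import Data.List.Relation.Unary.Any using (here; there)
open import Data.Nat as ℕ using (zero; suc)
import Data.Nat.Properties as ℕ
open import Data.Nat.Solver using (module +-*-Solver)
open import Data.Product using (_×_; _,_; proj₁; proj₂; ∃; ∃-syntax)
open import Data.Product.Relation.Binary.Lex.Strict using (×-strictTotalOrder)
open import Data.Rational using (1ℚ; ½; toℚᵘ; _≤ᵇ_) renaming (_+_ to _+ℚ_)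
import Data.Rational.Properties as ℚ
import Data.Rational.Unnormalised as ℚᵘ
import Data.Rational.Unnormalised.Properties as ℚᵘ
open import Data.Sum using (_⊎_; inj₁; inj₂; [_,_])
open import Data.Vec using ([]; _∷_; zipWith; lookup; here; there)
import Data.Vec.Properties as Vec
open import Function using (_∘_; _⇔_; mk⇔; Equivalence; case_of_)
open import Level using (0ℓ)
open import Relation.Binary using (StrictTotalOrder; tri<; tri≈; tri>)
import Relation.Binary.Construct.On as On
open import Relation.Binary.PropositionalEquality
  using (refl; sym; trans; cong; cong₂; subst; _≢_; module ≡-Reasoning)
open import Relation.Nullary using (yes; no; does; ¬_; contradiction)
open import Relation.Nullary.Decidable using (_×-dec_; does-⇔) renaming (T? to True?)
open import Relation.Unary using (Pred; Decidable)

open import Algebra.Properties.CommutativeSemigroup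
  (CommutativeMonoid.commutativeSemigroup ℚ.+-0-commutativeMonoid) using (interchange; x∙yz≈y∙xz)
open import Algebra.Properties.Semiring.Mult (CommutativeRing.semiring ℚ.+-*-commutativeRing)
  using () renaming (_×_ to _·_; ×-homo-+ to ·-homo-+; ×-assoc-* to ·-assoc-*)

private
  variable
    A B : Set
    m : ℕ

-- Finite sums and averages

∑ : List A → (A → ℚ) → ℚ
∑ xs f = foldr _+ℚ_ 0ℚ (map f xs)

infixr 6.5 ∑
syntax ∑ xs (λ x → e) = ∑[ x ← xs ] e

∑-++ : ∀ xs ys (f : A → ℚ) → ∑ (xs ++ ys) f ≡ ∑ xs f +ℚ ∑ ys f
∑-++ []       ys f = sym (ℚ.+-identityˡ _)
∑-++ (x ∷ xs) ys f = trans (cong (f x +ℚ_) (∑-++ xs ys f)) (sym (ℚ.+-assoc (f x) _ _))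

∑-map : ∀ (g : B → A) xs (f : A → ℚ) → ∑ (map g xs) f ≡ ∑ xs (f ∘ g)
∑-map g xs f = cong (foldr _+ℚ_ 0ℚ) (sym (List.map-∘ xs))

∑-cong : ∀ xs {f g : A → ℚ} → (∀ {x} → x ∈ˡ xs → f x ≡ g x) → ∑ xs f ≡ ∑ xs g
∑-cong []       f≡g = refl
∑-cong (x ∷ xs) f≡g = cong₂ _+ℚ_ (f≡g (here refl)) (∑-cong xs (f≡g ∘ there))

∑-mono : ∀ xs {f g : A → ℚ} → (∀ {x} → x ∈ˡ xs → f x ≤ g x) → ∑ xs f ≤ ∑ xs g
∑-mono []       f≤g = ℚ.≤-refl
∑-mono (x ∷ xs) f≤g = ℚ.+-mono-≤ (f≤g (here refl)) (∑-mono xs (f≤g ∘ there))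

∑-nonneg : ∀ xs {f : A → ℚ} → (∀ x → 0ℚ ≤ f x) → 0ℚ ≤ ∑ xs f
∑-nonneg []       f≥0 = ℚ.≤-refl
∑-nonneg (x ∷ xs) f≥0 = ℚ.+-mono-≤ (f≥0 x) (∑-nonneg xs f≥0)

∑-zero : ∀ (xs : List A) → ∑[ x ← xs ] 0ℚ ≡ 0ℚ
∑-zero []       = refl
∑-zero (x ∷ xs) = trans (ℚ.+-identityˡ _) (∑-zero xs)

∑-+ : ∀ xs (f g : A → ℚ) → ∑[ x ← xs ] (f x +ℚ g x) ≡ ∑ xs f +ℚ ∑ xs g
∑-+ []       f g = refl
∑-+ (x ∷ xs) f g =
  trans (cong (f x +ℚ g x +ℚ_) (∑-+ xs f g)) (interchange (f x) (g x) (∑ xs f) (∑ xs g))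

∑-*ˡ : ∀ xs c (f : A → ℚ) → ∑[ x ← xs ] c * f x ≡ c * ∑ xs f
∑-*ˡ []       c f = sym (ℚ.*-zeroʳ c)
∑-*ˡ (x ∷ xs) c f = trans (cong (c * f x +ℚ_) (∑-*ˡ xs c f)) (sym (ℚ.*-distribˡ-+ c (f x) _))

∑-*ʳ : ∀ xs c (f : A → ℚ) → ∑[ x ← xs ] f x * c ≡ ∑ xs f * c
∑-*ʳ []       c f = sym (ℚ.*-zeroˡ c)
∑-*ʳ (x ∷ xs) c f = trans (cong (f x * c +ℚ_) (∑-*ʳ xs c f)) (sym (ℚ.*-distribʳ-+ c (f x) _))

∑-const : ∀ (xs : List A) c → ∑[ x ← xs ] c ≡ length xs · c
∑-const []       c = refl
∑-const (x ∷ xs) c = cong (c +ℚ_) (∑-const xs c)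

∑-≤-· : ∀ xs {f : A → ℚ} {c} → (∀ {x} → x ∈ˡ xs → f x ≤ c) → ∑ xs f ≤ length xs · c
∑-≤-· xs f≤c = ℚ.≤-trans (∑-mono xs f≤c) (ℚ.≤-reflexive (∑-const xs _))

·-≤-∑ : ∀ xs {f : A → ℚ} {c} → (∀ {x} → x ∈ˡ xs → c ≤ f x) → length xs · c ≤ ∑ xs f
·-≤-∑ xs c≤f = ℚ.≤-trans (ℚ.≤-reflexive (sym (∑-const xs _))) (∑-mono xs c≤f)

∑-swap : ∀ xs ys (f : A → B → ℚ) →
         ∑[ x ← xs ] ∑[ y ← ys ] f x y ≡ ∑[ y ← ys ] ∑[ x ← xs ] f x y
∑-swap []       ys f = sym (∑-zero ys)
∑-swap (x ∷ xs) ys f =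
  trans (cong (∑ ys (f x) +ℚ_) (∑-swap xs ys f)) (sym (∑-+ ys (f x) (λ y → ∑[ x ← xs ] f x y)))

module _ {P : Pred A 0ℓ} (P? : Decidable P) where

  ∑-filter : ∀ xs (f : A → ℚ) → ∑ (filter P? xs) f ≡ ∑[ x ← xs ] (if does (P? x) then f x else 0ℚ)
  ∑-filter []       f = refl
  ∑-filter (x ∷ xs) f with does (P? x)
  ... | true  = cong (f x +ℚ_) (∑-filter xs f)
  ... | false = trans (∑-filter xs f) (sym (ℚ.+-identityˡ _))

  ∑-filter-split : {Q R : Pred A 0ℓ} (Q? : Decidable Q) (R? : Decidable R) →
                   (∀ {x} → P x ⇔ (Q x ⊎ R x)) → (∀ {x} → Q x → ¬ R x) → ∀ xs (f : A → ℚ) →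
                   ∑ (filter P? xs) f ≡ ∑ (filter Q? xs) f +ℚ ∑ (filter R? xs) f
  ∑-filter-split Q? R? P⇔Q⊎R Q∩R=∅ []       f = sym (ℚ.+-identityˡ 0ℚ)
  ∑-filter-split Q? R? P⇔Q⊎R Q∩R=∅ (x ∷ xs) f
    with ih ← ∑-filter-split Q? R? P⇔Q⊎R Q∩R=∅ xs f | P? x | Q? x | R? x
  ... | yes _ | yes _ | no _  = trans (cong (f x +ℚ_) ih) (sym (ℚ.+-assoc (f x) _ _))
  ... | yes _ | no _  | yes _ =
    trans (cong (f x +ℚ_) ih) (x∙yz≈y∙xz (f x) (∑ (filter Q? xs) f) (∑ (filter R? xs) f))
  ... | no _  | no _  | no _  = ih
  ... | _     | yes q | yes r = contradiction r (Q∩R=∅ q)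
  ... | yes p | no ¬q | no ¬r = ⊥-elim ([ ¬q , ¬r ] (Equivalence.to P⇔Q⊎R p))
  ... | no ¬p | yes q | _     = contradiction (Equivalence.from P⇔Q⊎R (inj₁ q)) ¬p
  ... | no ¬p | _     | yes r = contradiction (Equivalence.from P⇔Q⊎R (inj₂ r)) ¬p

∑-filter-∑-filter : {P : Pred A 0ℓ} {Q : A → Pred B 0ℓ} (P? : Decidable P) (Q? : ∀ x → Decidable (Q x)) →
                    ∀ xs ys (f : A → B → ℚ) →
                    ∑[ x ← filter P? xs ] ∑[ y ← filter (Q? x) ys ] f x y
                    ≡ ∑[ x ← xs ] ∑[ y ← ys ] (if does (P? x) ∧ does (Q? x y) then f x y else 0ℚ)
∑-filter-∑-filter P? Q? xs ys f =
  trans (∑-filter P? xs _) (∑-cong xs (λ {x} _ → inner x (does (P? x))))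
  where
  inner : ∀ x b → (if b then ∑ (filter (Q? x) ys) (f x) else 0ℚ)
                  ≡ ∑[ y ← ys ] (if b ∧ does (Q? x y) then f x y else 0ℚ)
  inner x true  = ∑-filter (Q? x) ys (f x)
  inner x false = sym (∑-zero ys)

p≤p+q : ∀ p {q} → 0ℚ ≤ q → p ≤ p +ℚ q
p≤p+q p q≥0 = ℚ.≤-trans (ℚ.≤-reflexive (sym (ℚ.+-identityʳ p))) (ℚ.+-monoʳ-≤ p q≥0)

·-nonneg : ∀ n {c} → 0ℚ ≤ c → 0ℚ ≤ n · c
·-nonneg zero    c≥0 = ℚ.≤-refl
·-nonneg (suc n) c≥0 = ℚ.+-mono-≤ c≥0 (·-nonneg n c≥0)

·-monoˡ-≤ : ∀ {m n} c → m ℕ.≤ n → 0ℚ ≤ c → m · c ≤ n · c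
·-monoˡ-≤ {n = n} c ℕ.z≤n       c≥0 = ·-nonneg n c≥0
·-monoˡ-≤         c (ℕ.s≤s m≤n) c≥0 = ℚ.+-monoʳ-≤ c (·-monoˡ-≤ c m≤n c≥0)

½*-double : ∀ x → ½ * (x +ℚ x) ≡ x
½*-double x = trans (ℚ.*-distribˡ-+ ½ x x) (trans (sym (ℚ.*-distribʳ-+ x ½ ½)) (ℚ.*-identityˡ x))

½*·-≤ : ∀ m n {c} → m ℕ.≤ n + n → 0ℚ ≤ c → ½ * (m · c) ≤ n · c
½*·-≤ m n {c} m≤2n c≥0 = begin
  ½ * (m · c)           ≤⟨ ℚ.*-monoˡ-≤-nonNeg ½ (·-monoˡ-≤ c m≤2n c≥0) ⟩
  ½ * ((n + n) · c)     ≡⟨ cong (½ *_) (·-homo-+ c n n) ⟩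
  ½ * (n · c +ℚ n · c)  ≡⟨ ½*-double (n · c) ⟩
  n · c                 ∎
  where open ℚ.≤-Reasoning

toℚᵘ-·1 : ∀ n → toℚᵘ (n · 1ℚ) ℚᵘ.≃ ℚᵘ.mkℚᵘ (+ n) 0
toℚᵘ-·1 zero    = ℚᵘ.*≡* refl
toℚᵘ-·1 (suc n) = ℚᵘ.≃-trans (ℚ.toℚᵘ-homo-+ 1ℚ (n · 1ℚ))
                    (ℚᵘ.≃-trans (ℚᵘ.+-congʳ (toℚᵘ 1ℚ) (toℚᵘ-·1 n)) (ℚᵘ.*≡* 1+n))
  where
  1+n : (+ 1 ℤ.* + 1 ℤ.+ + n ℤ.* + 1) ℤ.* + 1 ≡ + suc n ℤ.* (+ 1 ℤ.* + 1)
  1+n = trans (ℤ.*-identityʳ _)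
              (trans (cong (λ z → + 1 ℤ.+ z) (ℤ.*-identityʳ (+ n))) (sym (ℤ.*-identityʳ (+ suc n))))

[1+n]·1*1/[1+n]≡1 : ∀ n → (suc n · 1ℚ) * (+ 1 / suc n) ≡ 1ℚ
[1+n]·1*1/[1+n]≡1 n = ℚ.toℚᵘ-injective (ℚᵘ.≃-trans (ℚ.toℚᵘ-homo-* (suc n · 1ℚ) (+ 1 / suc n))
  (ℚᵘ.≃-trans (ℚᵘ.*-cong (toℚᵘ-·1 (suc n)) (ℚ.toℚᵘ-fromℚᵘ (ℚᵘ.mkℚᵘ (+ 1) n))) (ℚᵘ.*≡* 1+n/1+n)))
  where
  1+n/1+n : (+ suc n ℤ.* + 1) ℤ.* + 1 ≡ + 1 ℤ.* (+ 1 ℤ.* + suc n)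
  1+n/1+n = trans (ℤ.*-identityʳ _) (trans (ℤ.*-identityʳ (+ suc n))
                  (sym (trans (ℤ.*-identityˡ _) (ℤ.*-identityˡ (+ suc n)))))

[1+n]·c*1/[1+n]≡c : ∀ n c → (suc n · c) * (+ 1 / suc n) ≡ c
[1+n]·c*1/[1+n]≡c n c = begin
  (suc n · c) * q         ≡⟨ cong (_* q) (trans (·-assoc-* (suc n) 1ℚ c) (cong (suc n ·_) (ℚ.*-identityˡ c))) ⟨
  (suc n · 1ℚ) * c * q    ≡⟨ ℚ.*-assoc (suc n · 1ℚ) c q ⟩
  (suc n · 1ℚ) * (c * q)  ≡⟨ cong ((suc n · 1ℚ) *_) (ℚ.*-comm c q) ⟩
  (suc n · 1ℚ) * (q * c)  ≡⟨ sym (ℚ.*-assoc (suc n · 1ℚ) q c) ⟩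
  (suc n · 1ℚ) * q * c    ≡⟨ cong (_* c) ([1+n]·1*1/[1+n]≡1 n) ⟩
  1ℚ * c                  ≡⟨ ℚ.*-identityˡ c ⟩
  c                       ∎
  where
  open ≡-Reasoning
  q = + 1 / suc n

mean-map : ∀ {M} (f : A → ℚ) xs → length xs ≡ suc M → mean (map f xs) ≡ ∑ xs f * (+ 1 / suc M)
mean-map f (x ∷ xs) refl = cong (λ l → ∑ (x ∷ xs) f * (+ 1 / suc l)) (List.length-map f xs)

mean-*ˡ : ∀ c (f : A → ℚ) xs → c * mean (map f xs) ≡ mean (map (λ x → c * f x) xs)
mean-*ˡ c f []       = ℚ.*-zeroʳ c
mean-*ˡ c f (x ∷ xs) = begin
  c * mean (map f (x ∷ xs))            ≡⟨ cong (c *_) (mean-map f (x ∷ xs) refl) ⟩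
  c * (∑ (x ∷ xs) f * q)               ≡⟨ sym (ℚ.*-assoc c _ q) ⟩
  c * ∑ (x ∷ xs) f * q                 ≡⟨ cong (_* q) (sym (∑-*ˡ (x ∷ xs) c f)) ⟩
  (∑[ y ← x ∷ xs ] c * f y) * q        ≡⟨ sym (mean-map (λ y → c * f y) (x ∷ xs) refl) ⟩
  mean (map (λ y → c * f y) (x ∷ xs))  ∎
  where
  open ≡-Reasoning
  q = + 1 / suc (length xs)

mean-mono : ∀ (f g : A → ℚ) xs → ∑ xs f ≤ ∑ xs g → mean (map f xs) ≤ mean (map g xs)
mean-mono f g []       _   = ℚ.≤-refl
mean-mono f g (x ∷ xs) f≤g = begin
  mean (map f (x ∷ xs))  ≡⟨ mean-map f (x ∷ xs) refl ⟩
  ∑ (x ∷ xs) f * q       ≤⟨ ℚ.*-monoʳ-≤-nonNeg q {{ℚ.normalize-nonNeg 1 (suc (length xs))}} f≤g ⟩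
  ∑ (x ∷ xs) g * q       ≡⟨ sym (mean-map g (x ∷ xs) refl) ⟩
  mean (map g (x ∷ xs))  ∎
  where
  open ℚ.≤-Reasoning
  q = + 1 / suc (length xs)

mean-of-means-mono : ∀ M (sample : A → List B) (Hs : List A) (a : A → ℚ) (b : A → B → ℚ) →
                     (∀ {H} → H ∈ˡ Hs → length (sample H) ≡ suc M) →
                     ∑[ H ← Hs ] ∑[ T ← sample H ] a H ≤ ∑[ H ← Hs ] ∑[ T ← sample H ] b H T →
                     mean (map a Hs) ≤ mean (map (λ H → mean (map (b H) (sample H))) Hs)
mean-of-means-mono M sample Hs a b len ∑∑a≤∑∑b = mean-mono _ _ Hs (begin
  ∑[ H ← Hs ] a H                            ≡⟨ ∑-cong Hs a≡avg ⟩
  ∑[ H ← Hs ] (∑[ T ← sample H ] a H) * q    ≡⟨ ∑-*ʳ Hs q _ ⟩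
  (∑[ H ← Hs ] ∑[ T ← sample H ] a H) * q    ≤⟨ ℚ.*-monoʳ-≤-nonNeg q {{ℚ.normalize-nonNeg 1 (suc M)}}
                                                                      ∑∑a≤∑∑b ⟩
  (∑[ H ← Hs ] ∑[ T ← sample H ] b H T) * q  ≡⟨ sym (∑-*ʳ Hs q _) ⟩
  ∑[ H ← Hs ] (∑[ T ← sample H ] b H T) * q  ≡⟨ ∑-cong Hs (λ H∈ → sym (mean-map (b _) (sample _) (len H∈))) ⟩
  ∑[ H ← Hs ] mean (map (b H) (sample H))    ∎)
  where
  open ℚ.≤-Reasoning
  q = + 1 / suc M
  a≡avg : ∀ {H} → H ∈ˡ Hs → a H ≡ (∑[ T ← sample H ] a H) * q
  a≡avg {H} H∈ = sym (trans (cong (_* q) (trans (∑-const (sample H) (a H)) (cong (_· a H) (len H∈))))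
                            ([1+n]·c*1/[1+n]≡c M (a H)))

-- Binomial coefficients

-- binom p q is the binomial coefficient (p + q choose p); splitting the top index into its two
-- parts makes both Pascal's rule and the symmetry structural.
binom : ℕ → ℕ → ℕ
binom zero    q       = 1
binom (suc p) zero    = 1
binom (suc p) (suc q) = binom p (suc q) + binom (suc p) q

binom-zeroʳ : ∀ p → binom p 0 ≡ 1
binom-zeroʳ zero    = refl
binom-zeroʳ (suc p) = refl

binom-oneˡ : ∀ q → binom 1 q ≡ suc q
binom-oneˡ zero    = refl
binom-oneˡ (suc q) = cong suc (binom-oneˡ q)

binom-comm : ∀ p q → binom p q ≡ binom q p
binom-comm zero    q       = sym (binom-zeroʳ q)
binom-comm (suc p) zero    = refl
binom-comm (suc p) (suc q) = trans (cong₂ _+_ (binom-comm p (suc q)) (binom-comm (suc p) q))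
                                   (ℕ.+-comm (binom (suc q) p) (binom q (suc p)))

binom-nonZero : ∀ p q → ∃[ M ] binom p q ≡ suc M
binom-nonZero zero    q       = 0 , refl
binom-nonZero (suc p) zero    = 0 , refl
binom-nonZero (suc p) (suc q) with M , eq ← binom-nonZero p (suc q) =
  M + binom (suc p) q , cong (_+ binom (suc p) q) eq

binom-ratio : ∀ p q → suc q ℕ.* binom p (suc q) ≡ suc p ℕ.* binom (suc p) q
binom-ratio zero    q       = trans (ℕ.*-identityʳ (suc q)) (sym (trans (ℕ.*-identityˡ _) (binom-oneˡ q)))
binom-ratio (suc p) zero    = trans (ℕ.*-identityˡ _)
  (trans (trans (binom-comm (suc p) 1) (binom-oneˡ (suc p))) (sym (ℕ.*-identityʳ (suc (suc p)))))
binom-ratio (suc p) (suc q) = begin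
  suc (suc q) ℕ.* (binom p (suc (suc q)) + X)
    ≡⟨ ℕ.*-distribˡ-+ (suc (suc q)) (binom p (suc (suc q))) X ⟩
  suc (suc q) ℕ.* binom p (suc (suc q)) + suc (suc q) ℕ.* X
    ≡⟨ cong (λ z → z + suc (suc q) ℕ.* X) (binom-ratio p (suc q)) ⟩
  suc p ℕ.* X + suc (suc q) ℕ.* X
    ≡⟨ solve 3 (λ p q X → (con 1 :+ p) :* X :+ (con 2 :+ q) :* X := (con 2 :+ p) :* X :+ (con 1 :+ q) :* X)
             refl p q X ⟩
  suc (suc p) ℕ.* X + suc q ℕ.* X
    ≡⟨ cong (λ z → suc (suc p) ℕ.* X + z) (binom-ratio (suc p) q) ⟩
  suc (suc p) ℕ.* X + suc (suc p) ℕ.* binom (suc (suc p)) q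
    ≡⟨ sym (ℕ.*-distribˡ-+ (suc (suc p)) X _) ⟩
  suc (suc p) ℕ.* (X + binom (suc (suc p)) q)  ∎
  where
  open ≡-Reasoning
  open +-*-Solver
  X = binom (suc p) (suc q)

binom-unimodal : ∀ {p q} → p ℕ.≤ q → binom p (suc q) ℕ.≤ binom (suc p) q
binom-unimodal {p} {q} p≤q = ℕ.*-cancelˡ-≤ (suc q) (begin
  suc q ℕ.* binom p (suc q)  ≡⟨ binom-ratio p q ⟩
  suc p ℕ.* binom (suc p) q  ≤⟨ ℕ.*-monoˡ-≤ (binom (suc p) q) (ℕ.s≤s p≤q) ⟩
  suc q ℕ.* binom (suc p) q  ∎)
  where open ℕ.≤-Reasoning

binom-≤-double : ∀ {p q} → p ℕ.≤ q → binom (suc p) (suc q) ℕ.≤ binom q (suc p) + binom q (suc p)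
binom-≤-double {p} {q} p≤q = begin
  binom p (suc q) + binom (suc p) q  ≤⟨ ℕ.+-monoˡ-≤ (binom (suc p) q) (binom-unimodal p≤q) ⟩
  binom (suc p) q + binom (suc p) q  ≡⟨ cong (λ z → z + z) (binom-comm (suc p) q) ⟩
  binom q (suc p) + binom q (suc p)  ∎
  where open ℕ.≤-Reasoning

-- Subsets

filter-does-cong : {P Q : Pred A 0ℓ} (P? : Decidable P) (Q? : Decidable Q) →
                   (∀ x → does (P? x) ≡ does (Q? x)) → ∀ xs → filter P? xs ≡ filter Q? xs
filter-does-cong P? Q? P≡Q []       = refl
filter-does-cong P? Q? P≡Q (x ∷ xs) with does (P? x) | does (Q? x) | P≡Q x
... | true  | true  | refl = cong (x ∷_) (filter-does-cong P? Q? P≡Q xs)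
... | false | false | refl = filter-does-cong P? Q? P≡Q xs

length-filter-none : {P : Pred A 0ℓ} (P? : Decidable P) → (∀ x → ¬ P x) → ∀ xs →
                     length (filter P? xs) ≡ 0
length-filter-none P? ¬P xs = cong length (List.filter-none P? (universal ¬P xs))

length-filter-map : {P : Pred A 0ℓ} (P? : Decidable P) (g : B → A) → ∀ xs →
                    length (filter P? (map g xs)) ≡ length (filter (P? ∘ g) xs)
length-filter-map P? g []       = refl
length-filter-map P? g (x ∷ xs) with does (P? (g x))
... | true  = cong suc (length-filter-map P? g xs)
... | false = length-filter-map P? g xs

∑-allSubsets : ∀ m (f : Subset (suc m) → ℚ) →
               ∑ (allSubsets (suc m)) f
               ≡ ∑[ X ← allSubsets m ] f (outside ∷ X) +ℚ ∑[ X ← allSubsets m ] f (inside ∷ X)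
∑-allSubsets m f =
  trans (∑-++ (map (outside ∷_) (allSubsets m)) _ f)
        (cong₂ _+ℚ_ (∑-map (outside ∷_) (allSubsets m) f) (∑-map (inside ∷_) (allSubsets m) f))

length-filter-allSubsets : ∀ m {P : Pred (Subset (suc m)) 0ℓ} (P? : Decidable P) →
                           length (filter P? (allSubsets (suc m)))
                           ≡ length (filter (P? ∘ (outside ∷_)) (allSubsets m))
                             + length (filter (P? ∘ (inside ∷_)) (allSubsets m))
length-filter-allSubsets m P? = begin
  length (filter P? (allSubsets (suc m)))
    ≡⟨ cong length (List.filter-++ P? (map (outside ∷_) (allSubsets m)) _) ⟩
  length (filter P? (map (outside ∷_) (allSubsets m)) ++ filter P? (map (inside ∷_) (allSubsets m)))
    ≡⟨ List.length-++ (filter P? (map (outside ∷_) (allSubsets m))) ⟩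
  length (filter P? (map (outside ∷_) (allSubsets m))) + length (filter P? (map (inside ∷_) (allSubsets m)))
    ≡⟨ cong₂ _+_ (length-filter-map P? (outside ∷_) (allSubsets m))
                 (length-filter-map P? (inside ∷_) (allSubsets m)) ⟩
  length (filter (P? ∘ (outside ∷_)) (allSubsets m)) + length (filter (P? ∘ (inside ∷_)) (allSubsets m))  ∎
  where open ≡-Reasoning

∣p∣>0⇒Nonempty : ∀ (p : Subset m) → 0 ℕ.< ∣ p ∣ → Nonempty p
∣p∣>0⇒Nonempty (inside ∷ p)  _     = zero , here
∣p∣>0⇒Nonempty (outside ∷ p) ∣p∣>0 with x , x∈p ← ∣p∣>0⇒Nonempty p ∣p∣>0 = suc x , there x∈p

x∈p─q⇒x∉q : ∀ {x : Fin m} (p q : Subset m) → x ∈ p ─ q → x ∉ q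
x∈p─q⇒x∉q (s ∷ p) (outside ∷ q) here       ()
x∈p─q⇒x∉q (s ∷ p) (t ∷ q)       (there x∈) (there x∈q) = x∈p─q⇒x∉q p q x∈ x∈q

x∈p─q⇔ : ∀ {x : Fin m} {p q : Subset m} → x ∈ p ─ q ⇔ (x ∈ p × x ∉ q)
x∈p─q⇔ {p = p} {q} =
  mk⇔ (λ x∈ → p─q⊆p p q x∈ , x∈p─q⇒x∉q p q x∈) (λ (x∈p , x∉q) → x∈p∧x∉q⇒x∈p─q x∈p x∉q)

x∈p-y⁻ : ∀ {x y : Fin m} {p} → x ∈ p - y → x ∈ p × x ≢ y
x∈p-y⁻ {y = y} {p} x∈ = p─q⊆p p ⁅ y ⁆ x∈ , λ { refl → x∈p─q⇒x∉q p ⁅ y ⁆ x∈ (x∈⁅x⁆ y) }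

x∈p⇒⁅x⁆⊆p : ∀ {x : Fin m} {p} → x ∈ p → ⁅ x ⁆ ⊆ p
x∈p⇒⁅x⁆⊆p {x = x} {p} x∈p y∈⁅x⁆ = subst (_∈ p) (sym (x∈⁅y⁆⇒x≡y x y∈⁅x⁆)) x∈p

∣p─q∣+∣q∣≡∣p∣ : ∀ {p q : Subset m} → q ⊆ p → ∣ p ─ q ∣ + ∣ q ∣ ≡ ∣ p ∣
∣p─q∣+∣q∣≡∣p∣ {p = []}          {[]}          _   = refl
∣p─q∣+∣q∣≡∣p∣ {p = outside ∷ p} {outside ∷ q} q⊆p = ∣p─q∣+∣q∣≡∣p∣ (drop-∷-⊆ q⊆p)
∣p─q∣+∣q∣≡∣p∣ {p = inside ∷ p}  {outside ∷ q} q⊆p = cong suc (∣p─q∣+∣q∣≡∣p∣ (drop-∷-⊆ q⊆p))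
∣p─q∣+∣q∣≡∣p∣ {p = inside ∷ p}  {inside ∷ q}  q⊆p =
  trans (ℕ.+-suc ∣ p ─ q ∣ ∣ q ∣) (cong suc (∣p─q∣+∣q∣≡∣p∣ (drop-∷-⊆ q⊆p)))
∣p─q∣+∣q∣≡∣p∣ {p = outside ∷ p} {inside ∷ q}  q⊆p with () ← q⊆p here

1+∣p-x∣≡∣p∣ : ∀ {x : Fin m} {p} → x ∈ p → suc ∣ p - x ∣ ≡ ∣ p ∣
1+∣p-x∣≡∣p∣ {x = x} {p} x∈p = begin
  suc ∣ p - x ∣      ≡⟨ ℕ.+-comm 1 ∣ p - x ∣ ⟩
  ∣ p - x ∣ + 1      ≡⟨ cong (λ n → ∣ p - x ∣ + n) (sym (∣⁅x⁆∣≡1 x)) ⟩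
  ∣ p - x ∣ + ∣ ⁅ x ⁆ ∣  ≡⟨ ∣p─q∣+∣q∣≡∣p∣ (x∈p⇒⁅x⁆⊆p x∈p) ⟩
  ∣ p ∣              ∎
  where open ≡-Reasoning

∣p∪⁅x⁆∣≡1+∣p∣ : ∀ {p : Subset m} {x} → x ∉ p → ∣ p ∪ ⁅ x ⁆ ∣ ≡ suc ∣ p ∣
∣p∪⁅x⁆∣≡1+∣p∣ {p = outside ∷ p} {zero}  _   = cong (λ q → suc ∣ q ∣) (∪-identityʳ p)
∣p∪⁅x⁆∣≡1+∣p∣ {p = inside ∷ p}  {zero}  x∉p = contradiction here x∉p
∣p∪⁅x⁆∣≡1+∣p∣ {p = outside ∷ p} {suc x} x∉p = ∣p∪⁅x⁆∣≡1+∣p∣ (x∉p ∘ there)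
∣p∪⁅x⁆∣≡1+∣p∣ {p = inside ∷ p}  {suc x} x∉p = cong suc (∣p∪⁅x⁆∣≡1+∣p∣ (x∉p ∘ there))

p⊆q∧∣q∣≤∣p∣⇒q⊆p : ∀ {p q : Subset m} → p ⊆ q → ∣ q ∣ ℕ.≤ ∣ p ∣ → q ⊆ p
p⊆q∧∣q∣≤∣p∣⇒q⊆p {p = p} {q} p⊆q ∣q∣≤∣p∣ {x} x∈q with x ∈? p
... | yes x∈p = x∈p
... | no  x∉p = contradiction (ℕ.≤-trans ∣q∣≤∣p∣ (p⊆q⇒∣p∣≤∣q∣ p⊆q-x)) (ℕ.<⇒≱ (x∈p⇒∣p-x∣<∣p∣ x∈q))
  where
  p⊆q-x : p ⊆ q - x
  p⊆q-x y∈p = x∈p∧x≢y⇒x∈p-y (p⊆q y∈p) (λ { refl → x∉p y∈p })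

p⊆full : ∀ (p : Subset m) → p ⊆ full m
p⊆full (s ∷ p) here       = here
p⊆full (s ∷ p) (there x∈) = there (p⊆full p x∈)

compl-involutive : ∀ (p : Subset m) → compl (compl p) ≡ p
compl-involutive []            = refl
compl-involutive (outside ∷ p) = cong (outside ∷_) (compl-involutive p)
compl-involutive (inside ∷ p)  = cong (inside ∷_) (compl-involutive p)

∣compl-p∣+∣p∣≡n : ∀ (p : Subset m) → ∣ compl p ∣ + ∣ p ∣ ≡ m
∣compl-p∣+∣p∣≡n []            = refl
∣compl-p∣+∣p∣≡n (outside ∷ p) = cong suc (∣compl-p∣+∣p∣≡n p)
∣compl-p∣+∣p∣≡n (inside ∷ p)  = trans (ℕ.+-suc ∣ compl p ∣ ∣ p ∣) (cong suc (∣compl-p∣+∣p∣≡n p))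

infixl 6 _⊕_
_⊕_ : Subset m → Subset m → Subset m
_⊕_ = zipWith _xor_

p⊕q≡p─q : ∀ {p q : Subset m} → q ⊆ p → p ⊕ q ≡ p ─ q
p⊕q≡p─q {p = []}          {[]}          _   = refl
p⊕q≡p─q {p = outside ∷ p} {outside ∷ q} q⊆p = cong (outside ∷_) (p⊕q≡p─q (drop-∷-⊆ q⊆p))
p⊕q≡p─q {p = inside ∷ p}  {outside ∷ q} q⊆p = cong (inside ∷_) (p⊕q≡p─q (drop-∷-⊆ q⊆p))
p⊕q≡p─q {p = inside ∷ p}  {inside ∷ q}  q⊆p = cong (outside ∷_) (p⊕q≡p─q (drop-∷-⊆ q⊆p))
p⊕q≡p─q {p = outside ∷ p} {inside ∷ q}  q⊆p with () ← q⊆p here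

q⊆compl[p⊕q]⇔q⊆p : ∀ {p q : Subset m} → q ⊆ compl (p ⊕ q) ⇔ q ⊆ p
q⊆compl[p⊕q]⇔q⊆p {p = p} {q} =
  mk⇔ (λ q⊆ {_} x∈q → to p q x∈q (q⊆ x∈q)) (λ q⊆p {_} x∈q → from p q x∈q (q⊆p x∈q))
  where
  to : ∀ {x : Fin m} (p q : Subset m) → x ∈ q → x ∈ compl (p ⊕ q) → x ∈ p
  to (inside ∷ p) (inside ∷ q) here       here        = here
  to (s ∷ p)      (t ∷ q)      (there x∈) (there x∈′) = there (to p q x∈ x∈′)
  from : ∀ {x : Fin m} (p q : Subset m) → x ∈ q → x ∈ p → x ∈ compl (p ⊕ q)
  from (inside ∷ p) (inside ∷ q) here       here        = here
  from (s ∷ p)      (t ∷ q)      (there x∈) (there x∈′) = there (from p q x∈ x∈′)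

∑-allSubsets-compl-⊕ : ∀ (q : Subset m) (f : Subset m → ℚ) →
                       ∑[ p ← allSubsets m ] f (compl (p ⊕ q)) ≡ ∑ (allSubsets m) f
∑-allSubsets-compl-⊕         []            f = refl
∑-allSubsets-compl-⊕ {suc m} (outside ∷ q) f = begin
  ∑[ p ← allSubsets (suc m) ] f (compl (p ⊕ (outside ∷ q)))
    ≡⟨ ∑-allSubsets m _ ⟩
  ∑[ p ← allSubsets m ] f (inside ∷ compl (p ⊕ q)) +ℚ ∑[ p ← allSubsets m ] f (outside ∷ compl (p ⊕ q))
    ≡⟨ cong₂ _+ℚ_ (∑-allSubsets-compl-⊕ q (f ∘ (inside ∷_))) (∑-allSubsets-compl-⊕ q (f ∘ (outside ∷_))) ⟩
  ∑[ p ← allSubsets m ] f (inside ∷ p) +ℚ ∑[ p ← allSubsets m ] f (outside ∷ p)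
    ≡⟨ ℚ.+-comm (∑[ p ← allSubsets m ] f (inside ∷ p)) _ ⟩
  ∑[ p ← allSubsets m ] f (outside ∷ p) +ℚ ∑[ p ← allSubsets m ] f (inside ∷ p)
    ≡⟨ sym (∑-allSubsets m f) ⟩
  ∑ (allSubsets (suc m)) f  ∎
  where open ≡-Reasoning
∑-allSubsets-compl-⊕ {suc m} (inside ∷ q)  f = begin
  ∑[ p ← allSubsets (suc m) ] f (compl (p ⊕ (inside ∷ q)))
    ≡⟨ ∑-allSubsets m _ ⟩
  ∑[ p ← allSubsets m ] f (outside ∷ compl (p ⊕ q)) +ℚ ∑[ p ← allSubsets m ] f (inside ∷ compl (p ⊕ q))
    ≡⟨ cong₂ _+ℚ_ (∑-allSubsets-compl-⊕ q (f ∘ (outside ∷_))) (∑-allSubsets-compl-⊕ q (f ∘ (inside ∷_))) ⟩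
  ∑[ p ← allSubsets m ] f (outside ∷ p) +ℚ ∑[ p ← allSubsets m ] f (inside ∷ p)
    ≡⟨ sym (∑-allSubsets m f) ⟩
  ∑ (allSubsets (suc m)) f  ∎
  where open ≡-Reasoning

Between : ℕ → Subset m → Subset m → Subset m → Set
Between K L U T = L ⊆ T × T ⊆ U × ∣ T ∣ ≡ K

between? : ∀ K (L U : Subset m) → Decidable (Between K L U)
between? K L U T = L ⊆? T ×-dec T ⊆? U ×-dec ∣ T ∣ ℕ.≟ K

subsetsBetween : ℕ → Subset m → Subset m → List (Subset m)
subsetsBetween K L U = filter (between? K L U) (allSubsets _)

∈-subsetsBetween⁻ : ∀ {K} {L U T : Subset m} → T ∈ˡ subsetsBetween K L U → Between K L U T
∈-subsetsBetween⁻ {K = K} {L} {U} T∈ = proj₂ (∈-filter⁻ (between? K L U) {xs = allSubsets _} T∈)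

length-subsetsBetween : ∀ {L U : Subset m} p q → L ⊆ U → ∣ U ∣ ≡ ∣ L ∣ + (p + q) →
                        length (subsetsBetween (∣ L ∣ + p) L U) ≡ binom p q
length-subsetsBetween {L = []} {[]} zero    q _ _  = refl
length-subsetsBetween {L = []} {[]} (suc p) q _ ()
length-subsetsBetween {m = suc m} {inside ∷ L} {outside ∷ U} p q L⊆U _ with () ← L⊆U here
length-subsetsBetween {m = suc m} {outside ∷ L} {outside ∷ U} p q L⊆U ∣U∣≡ = begin
  length (subsetsBetween (∣ L ∣ + p) (outside ∷ L) (outside ∷ U))
    ≡⟨ length-filter-allSubsets m _ ⟩
  length (filter _ (allSubsets m)) + length (filter _ (allSubsets m))
    ≡⟨ cong₂ _+_ (cong length (filter-does-cong _ (between? (∣ L ∣ + p) L U) (λ _ → refl) (allSubsets m)))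
                 (length-filter-none _ (λ { T (_ , T⊆U , _) → case T⊆U here of λ () }) (allSubsets m)) ⟩
  length (subsetsBetween (∣ L ∣ + p) L U) + 0
    ≡⟨ ℕ.+-identityʳ _ ⟩
  length (subsetsBetween (∣ L ∣ + p) L U)
    ≡⟨ length-subsetsBetween p q (drop-∷-⊆ L⊆U) ∣U∣≡ ⟩
  binom p q  ∎
  where open ≡-Reasoning
length-subsetsBetween {m = suc m} {inside ∷ L} {inside ∷ U} p q L⊆U ∣U∣≡ = begin
  length (subsetsBetween (suc (∣ L ∣ + p)) (inside ∷ L) (inside ∷ U))
    ≡⟨ length-filter-allSubsets m _ ⟩
  length (filter _ (allSubsets m)) + length (filter _ (allSubsets m))
    ≡⟨ cong₂ _+_ (length-filter-none _ (λ { T (L⊆T , _) → case L⊆T here of λ () }) (allSubsets m))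
                 (cong length (filter-does-cong _ (between? (∣ L ∣ + p) L U) (λ _ → refl) (allSubsets m))) ⟩
  length (subsetsBetween (∣ L ∣ + p) L U)
    ≡⟨ length-subsetsBetween p q (drop-∷-⊆ L⊆U) (ℕ.suc-injective ∣U∣≡) ⟩
  binom p q  ∎
  where open ≡-Reasoning
length-subsetsBetween {m = suc m} {outside ∷ L} {inside ∷ U} p q L⊆U ∣U∣≡ =
  trans (length-filter-allSubsets m _) (pascal p q ∣U∣≡)
  where
  L⊆U′ = drop-∷-⊆ L⊆U
  without with′ : ℕ → ℕ
  without p = length (filter (between? (∣ L ∣ + p) (outside ∷ L) (inside ∷ U) ∘ (outside ∷_)) (allSubsets m))
  with′   p = length (filter (between? (∣ L ∣ + p) (outside ∷ L) (inside ∷ U) ∘ (inside ∷_)) (allSubsets m))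

  without≡ : ∀ p q → ∣ U ∣ ≡ ∣ L ∣ + (p + q) → without p ≡ binom p q
  without≡ p q ∣U∣≡ =
    trans (cong length (filter-does-cong _ (between? (∣ L ∣ + p) L U) (λ _ → refl) (allSubsets m)))
          (length-subsetsBetween p q L⊆U′ ∣U∣≡)

  with≡ : ∀ p q → ∣ U ∣ ≡ ∣ L ∣ + (p + q) → with′ (suc p) ≡ binom p q
  with≡ p q ∣U∣≡ =
    trans (cong length (filter-does-cong _ (between? (∣ L ∣ + p) L U) shift (allSubsets m)))
          (length-subsetsBetween p q L⊆U′ ∣U∣≡)
    where
    shift : ∀ T → does (between? (∣ L ∣ + suc p) (outside ∷ L) (inside ∷ U) (inside ∷ T))
                ≡ does (between? (∣ L ∣ + p) L U T)
    shift T = cong (λ K → does (L ⊆? T) ∧ does (T ⊆? U) ∧ (suc ∣ T ∣ ℕ.≡ᵇ K)) (ℕ.+-suc ∣ L ∣ p)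

  without≡0 : ∀ p → suc ∣ U ∣ ≡ ∣ L ∣ + p → without p ≡ 0
  without≡0 p ∣U∣≡ = length-filter-none _ (λ { T (_ , T⊆U , ∣T∣≡) →
    ℕ.<-irrefl (sym ∣U∣≡) (ℕ.s≤s (subst (ℕ._≤ ∣ U ∣) ∣T∣≡ (p⊆q⇒∣p∣≤∣q∣ (drop-∷-⊆ T⊆U)))) }) (allSubsets m)

  with≡0 : with′ 0 ≡ 0
  with≡0 = length-filter-none _ (λ { T (L⊆T , _ , ∣T∣≡) →
    ℕ.<-irrefl (sym (trans ∣T∣≡ (ℕ.+-identityʳ ∣ L ∣))) (ℕ.s≤s (p⊆q⇒∣p∣≤∣q∣ (drop-∷-⊆ L⊆T))) }) (allSubsets m)

  pascal : ∀ p q → suc ∣ U ∣ ≡ ∣ L ∣ + (p + q) → without p + with′ p ≡ binom p q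
  pascal zero    zero    ∣U∣≡ =
    ⊥-elim (ℕ.<-irrefl (sym (trans ∣U∣≡ (ℕ.+-identityʳ ∣ L ∣))) (ℕ.s≤s (p⊆q⇒∣p∣≤∣q∣ L⊆U′)))
  pascal zero    (suc q) ∣U∣≡ =
    cong₂ _+_ (without≡ 0 q (ℕ.suc-injective (trans ∣U∣≡ (ℕ.+-suc ∣ L ∣ q)))) with≡0
  pascal (suc p) zero    ∣U∣≡ =
    cong₂ _+_ (without≡0 (suc p) (trans ∣U∣≡ (cong (λ n → ∣ L ∣ + n) (ℕ.+-identityʳ (suc p)))))
              (trans (with≡ p 0 (ℕ.suc-injective (trans ∣U∣≡ (ℕ.+-suc ∣ L ∣ (p + 0))))) (binom-zeroʳ p))
  pascal (suc p) (suc q) ∣U∣≡ =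
    trans (cong₂ _+_ (without≡ (suc p) q (ℕ.suc-injective (trans ∣U∣≡ ∣L∣+[1+p+1+q]≡)))
                     (with≡ p (suc q) (ℕ.suc-injective (trans ∣U∣≡ (ℕ.+-suc ∣ L ∣ (p + suc q))))))
          (ℕ.+-comm (binom (suc p) q) (binom p (suc q)))
    where
    ∣L∣+[1+p+1+q]≡ : ∣ L ∣ + suc (p + suc q) ≡ suc (∣ L ∣ + suc (p + q))
    ∣L∣+[1+p+1+q]≡ = trans (ℕ.+-suc ∣ L ∣ (p + suc q)) (cong (λ n → suc (∣ L ∣ + n)) (ℕ.+-suc p q))

Between-split : ∀ {K} {L U T : Subset m} x →
                Between K L U T ⇔ (Between K L (U - x) T ⊎ Between K (L ∪ ⁅ x ⁆) U T)
Between-split {L = L} {U} {T} x = mk⇔ to from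
  where
  to : Between _ L U T → Between _ L (U - x) T ⊎ Between _ (L ∪ ⁅ x ⁆) U T
  to (L⊆T , T⊆U , ∣T∣≡) with x ∈? T
  ... | yes x∈T = inj₂ (L∪x⊆T , T⊆U , ∣T∣≡)
    where
    L∪x⊆T : L ∪ ⁅ x ⁆ ⊆ T
    L∪x⊆T y∈ with x∈p∪q⁻ L ⁅ x ⁆ y∈
    ... | inj₁ y∈L = L⊆T y∈L
    ... | inj₂ y∈x = subst (_∈ T) (sym (x∈⁅y⁆⇒x≡y x y∈x)) x∈T
  ... | no  x∉T = inj₁ (L⊆T , (λ y∈T → x∈p∧x≢y⇒x∈p-y (T⊆U y∈T) (λ { refl → x∉T y∈T })) , ∣T∣≡)
  from : Between _ L (U - x) T ⊎ Between _ (L ∪ ⁅ x ⁆) U T → Between _ L U T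
  from (inj₁ (L⊆T , T⊆U-x , ∣T∣≡)) = L⊆T , p─q⊆p U ⁅ x ⁆ ∘ T⊆U-x , ∣T∣≡
  from (inj₂ (L∪x⊆T , T⊆U , ∣T∣≡))  = L∪x⊆T ∘ x∈p∪q⁺ ∘ inj₁ , T⊆U , ∣T∣≡

Between-disjoint : ∀ {K} {L U T : Subset m} x → Between K L (U - x) T → ¬ Between K (L ∪ ⁅ x ⁆) U T
Between-disjoint {L = L} {U} x (_ , T⊆U-x , _) (L∪x⊆T , _) =
  x∈p─q⇒x∉q U ⁅ x ⁆ (T⊆U-x (L∪x⊆T (x∈p∪q⁺ (inj₂ (x∈⁅x⁆ x))))) (x∈⁅x⁆ x)

∑-subsetsBetween-split : ∀ K (L U : Subset m) x (f : Subset m → ℚ) →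
                         ∑ (subsetsBetween K L U) f
                         ≡ ∑ (subsetsBetween K L (U - x)) f +ℚ ∑ (subsetsBetween K (L ∪ ⁅ x ⁆) U) f
∑-subsetsBetween-split K L U x =
  ∑-filter-split (between? K L U) (between? K L (U - x)) (between? K (L ∪ ⁅ x ⁆) U)
                 (Between-split x) (Between-disjoint x) (allSubsets _)

subsetsOfSize≡subsetsBetween : ∀ k (U : Subset m) → subsetsOfSize k U ≡ subsetsBetween k ⊥ U
subsetsOfSize≡subsetsBetween k U = List.filter-≐ _ (between? k ⊥ U) (to , from) (allSubsets _)
  where
  to : ∀ {T} → ∣ T ∣ ≡ k × T ⊆ U → Between k ⊥ U T
  to (∣T∣≡k , T⊆U) = ⊥⊆ , T⊆U , ∣T∣≡k
  from : ∀ {T} → Between k ⊥ U T → ∣ T ∣ ≡ k × T ⊆ U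
  from (_ , T⊆U , ∣T∣≡k) = ∣T∣≡k , T⊆U

∈-subsetsOfSize⁻ : ∀ {k} {U T : Subset m} → T ∈ˡ subsetsOfSize k U → ∣ T ∣ ≡ k
∈-subsetsOfSize⁻ {k = k} {U} T∈ =
  proj₁ (proj₂ (∈-filter⁻ (λ T → ∣ T ∣ ℕ.≟ k ×-dec T ⊆? U) {xs = allSubsets _} T∈))

length-subsetsOfSize : ∀ k q {U : Subset m} → ∣ U ∣ ≡ k + q → length (subsetsOfSize k U) ≡ binom k q
length-subsetsOfSize {m} k q {U} ∣U∣≡ = begin
  length (subsetsOfSize k U)                       ≡⟨ cong length (subsetsOfSize≡subsetsBetween k U) ⟩
  length (subsetsBetween k ⊥ U)                    ≡⟨ cong (λ K → length (subsetsBetween K ⊥ U)) 0+k≡k ⟨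
  length (subsetsBetween (∣ ⊥ {n = m} ∣ + k) ⊥ U)  ≡⟨ length-subsetsBetween {L = ⊥} {U} k q ⊥⊆ ∣U∣≡∣⊥∣+ ⟩
  binom k q                                        ∎
  where
  open ≡-Reasoning
  0+k≡k : ∣ ⊥ {n = m} ∣ + k ≡ k
  0+k≡k = cong (_+ k) (∣⊥∣≡0 m)
  ∣U∣≡∣⊥∣+ : ∣ U ∣ ≡ ∣ ⊥ {n = m} ∣ + (k + q)
  ∣U∣≡∣⊥∣+ = trans ∣U∣≡ (cong (_+ (k + q)) (sym (∣⊥∣≡0 m)))

subsetsOfSize-uniform : ∀ k h → k ℕ.≤ h →
                        ∃[ M ] ∀ {U : Subset m} → ∣ U ∣ ≡ h → length (subsetsOfSize k U) ≡ suc M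
subsetsOfSize-uniform k h k≤h with q , k+q≡h ← ℕ.m≤n⇒∃[o]m+o≡n k≤h with M , binom≡1+M ← binom-nonZero k q =
  M , λ {U} ∣U∣≡h → trans (length-subsetsOfSize k q {U} (trans ∣U∣≡h (sym k+q≡h))) binom≡1+M

-- Candidates ordered by value

module Candidates {m} (v : Fin m → ℚ) where

  rank : Fin m → ℚ × ℕ
  rank i = v i , toℕ i

  order : StrictTotalOrder 0ℓ 0ℓ 0ℓ
  order = On.strictTotalOrder (×-strictTotalOrder ℚ.<-strictTotalOrder ℕ.<-strictTotalOrder) rank

  open StrictTotalOrder order public using () renaming (_<_ to _≺_; trans to ≺-trans; asym to ≺-asym)

  infix 4 _≼_
  _≼_ : Fin m → Fin m → Set
  i ≼ j = i ≡ j ⊎ i ≺ j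

  ≼-trans : ∀ {i j k} → i ≼ j → j ≼ k → i ≼ k
  ≼-trans (inj₁ refl) j≼k         = j≼k
  ≼-trans (inj₂ i≺j)  (inj₁ refl) = inj₂ i≺j
  ≼-trans (inj₂ i≺j)  (inj₂ j≺k)  = inj₂ (≺-trans i≺j j≺k)

  ≺-total : ∀ i j → i ≺ j ⊎ j ≼ i
  ≺-total i j with StrictTotalOrder.compare order i j
  ... | tri< i≺j _ _             = inj₁ i≺j
  ... | tri≈ _ (_ , toℕi≡toℕj) _ = inj₂ (inj₁ (sym (Fin.toℕ-injective toℕi≡toℕj)))
  ... | tri> _ _ j≺i             = inj₂ (inj₂ j≺i)

  ≺⇒≤ : ∀ {i j} → i ≺ j → v i ≤ v j
  ≺⇒≤ (inj₁ vi<vj)       = ℚ.<⇒≤ vi<vj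
  ≺⇒≤ (inj₂ (vi≡vj , _)) = ℚ.≤-reflexive vi≡vj

  ≼⇒≤ : ∀ {i j} → i ≼ j → v i ≤ v j
  ≼⇒≤ (inj₁ refl) = ℚ.≤-refl
  ≼⇒≤ (inj₂ i≺j)  = ≺⇒≤ i≺j

  beats⇒≺ : ∀ {i j} → True (beats v i j) → j ≺ i
  beats⇒≺ {i} {j} _ with v i ≤ᵇ v j in e₁ | v j ≤ᵇ v i in e₂ | toℕ j ℕ.<ᵇ toℕ i in e₃
  ... | true  | true | true =
    inj₂ (ℚ.≤-antisym (≤ᵇ⇒≤ e₂) (≤ᵇ⇒≤ e₁) , ℕ.<ᵇ⇒< _ _ (Equivalence.from T-≡ e₃))
    where
    ≤ᵇ⇒≤ : ∀ {p q} → (p ≤ᵇ q) ≡ true → p ≤ q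
    ≤ᵇ⇒≤ = ℚ.≤ᵇ⇒≤ ∘ Equivalence.from T-≡
  ... | false | true | _    = inj₁ (ℚ.≰⇒> (λ vi≤vj → subst True e₁ (ℚ.≤⇒≤ᵇ vi≤vj)))

  ≺⇒beats : ∀ {i j} → j ≺ i → True (beats v i j)
  ≺⇒beats {i} {j} j≺i with v i ≤ᵇ v j in e₁ | v j ≤ᵇ v i in e₂ | toℕ j ℕ.<ᵇ toℕ i in e₃ | j≺i
  ... | true  | true  | true  | _                = _
  ... | false | true  | _     | _                = _
  ... | true  | _     | _     | inj₁ vj<vi       =
    ⊥-elim (ℚ.<-irrefl refl (ℚ.<-≤-trans vj<vi (ℚ.≤ᵇ⇒≤ (Equivalence.from T-≡ e₁))))
  ... | _     | false | _     | inj₁ vj<vi       = ⊥-elim (subst True e₂ (ℚ.≤⇒≤ᵇ (ℚ.<⇒≤ vj<vi)))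
  ... | false | _     | _     | inj₂ (vj≡vi , _) = ⊥-elim (subst True e₁ (ℚ.≤⇒≤ᵇ (ℚ.≤-reflexive (sym vj≡vi))))
  ... | _     | false | _     | inj₂ (vj≡vi , _) = ⊥-elim (subst True e₂ (ℚ.≤⇒≤ᵇ (ℚ.≤-reflexive vj≡vi)))
  ... | true  | true  | false | inj₂ (_ , j<i)   = ⊥-elim (subst True e₃ (ℕ.<⇒<ᵇ j<i))

  ∈-members⁺ : ∀ {x} {p : Subset m} → x ∈ p → x ∈ˡ members p
  ∈-members⁺ {x} {p} x∈p =
    ∈-filter⁺ (True? ∘ lookup p) (∈-allFin x) (Equivalence.from T-≡ (Vec.[]=⇒lookup x∈p))

  ∈-members⁻ : ∀ {x} {p : Subset m} → x ∈ˡ members p → x ∈ p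
  ∈-members⁻ {x} {p} x∈ =
    Vec.lookup⇒[]= x p (Equivalence.to T-≡ (proj₂ (∈-filter⁻ (True? ∘ lookup p) {xs = allFin m} x∈)))

  maximum : ∀ {u} xs → u ∈ˡ xs → ∃[ y ] y ∈ˡ xs × (∀ {z} → z ∈ˡ xs → z ≼ y)
  maximum (x ∷ [])      _ = x , here refl , λ { (here refl) → inj₁ refl }
  maximum (x ∷ x′ ∷ xs) _ with y , y∈ , xs≼y ← maximum (x′ ∷ xs) (here refl) | ≺-total x y
  ... | inj₁ x≺y = y , there y∈ , λ { (here refl) → inj₂ x≺y ; (there z∈) → xs≼y z∈ }
  ... | inj₂ y≼x = x , here refl , λ { (here refl) → inj₁ refl ; (there z∈) → ≼-trans (xs≼y z∈) y≼x }

  IsTop : Subset m → Fin m → Set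
  IsTop U x = x ∈ U × (∀ {z} → z ∈ U → z ≼ x)

  top : ∀ U → 0 ℕ.< ∣ U ∣ → ∃ (IsTop U)
  top U ∣U∣>0 with u , u∈U ← ∣p∣>0⇒Nonempty U ∣U∣>0
              with y , y∈ , ≼y ← maximum (members U) (∈-members⁺ u∈U) =
    y , ∈-members⁻ y∈ , ≼y ∘ ∈-members⁺

  aboveAll⁻ : ∀ {T c t} → True (aboveAll v T c) → t ∈ T → t ≺ c
  aboveAll⁻ {T} {c} above t∈T = beats⇒≺ (go (members T) above (∈-members⁺ t∈T))
    where
    go : ∀ ts {t} → True (foldr (λ t acc → beats v c t ∧ acc) true ts) → t ∈ˡ ts → True (beats v c t)
    go (t ∷ ts) all (here refl) = proj₁ (Equivalence.to T-∧ all)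
    go (t ∷ ts) all (there t∈)  = go ts (proj₂ (Equivalence.to (T-∧ {beats v c t}) all)) t∈

  aboveAll⁺ : ∀ {T c} → (∀ {t} → t ∈ T → t ≺ c) → True (aboveAll v T c)
  aboveAll⁺ {T} {c} T≺c = go (members T) (T≺c ∘ ∈-members⁻)
    where
    go : ∀ ts → (∀ {t} → t ∈ˡ ts → t ≺ c) → True (foldr (λ t acc → beats v c t ∧ acc) true ts)
    go []       _    = _
    go (t ∷ ts) ts≺c = Equivalence.from T-∧ (≺⇒beats (ts≺c (here refl)) , go ts (ts≺c ∘ there))

  LowestAbove : Subset m → Subset m → Fin m → Set
  LowestAbove T O x = x ∈ O × (∀ {t} → t ∈ T → t ≺ x) × (∀ {z} → z ∈ O → z ≺ x → ∃[ t ] t ∈ T × z ≺ t)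

  alg2-≥-lowestAbove : ∀ {T O x} σ → σ ↭ members O → LowestAbove T O x → v x ≤ alg2 v T σ
  alg2-≥-lowestAbove {T} {O} {x} σ σ↭O (x∈O , T≺x , below) =
    go σ (∈-members⁻ ∘ ∈-resp-↭ σ↭O) (∈-resp-↭ (↭-sym σ↭O) (∈-members⁺ x∈O))
    where
    go : ∀ cs → (∀ {c} → c ∈ˡ cs → c ∈ O) → x ∈ˡ cs → v x ≤ alg2 v T cs
    go (c ∷ cs) cs⊆O x∈cs with aboveAll v T c in above
    ... | true = ≼⇒≤ x≼c
      where
      x≼c : x ≼ c
      x≼c with ≺-total c x
      ... | inj₂ x≼c = x≼c
      ... | inj₁ c≺x with t , t∈T , c≺t ← below (cs⊆O (here refl)) c≺x =
        ⊥-elim (≺-asym c≺t (aboveAll⁻ (subst True (sym above) _) t∈T))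
    ... | false with x∈cs
    ...   | here refl   = ⊥-elim (subst True above (aboveAll⁺ T≺x))
    ...   | there x∈cs′ = go cs (cs⊆O ∘ there) x∈cs′

  alg2-nonneg : (∀ i → 0ℚ ≤ v i) → ∀ T σ → 0ℚ ≤ alg2 v T σ
  alg2-nonneg v≥0 T []      = ℚ.≤-refl
  alg2-nonneg v≥0 T (c ∷ σ) with aboveAll v T c
  ... | true  = v≥0 c
  ... | false = alg2-nonneg v≥0 T σ

  maxVal-≤ : ∀ cs {y} → 0ℚ ≤ y → (∀ {c} → c ∈ˡ cs → v c ≤ y) → maxVal v cs ≤ y
  maxVal-≤ []       y≥0 _    = y≥0
  maxVal-≤ (c ∷ cs) y≥0 cs≤y = ℚ.⊔-lub (cs≤y (here refl)) (maxVal-≤ cs y≥0 (cs≤y ∘ there))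

  -- G and F stand for OPT and ALG as functions of the sample T ⊆ S.
  module Peeling (v≥0 : ∀ i → 0ℚ ≤ v i) (k : ℕ) (S : Subset m) (∣S∣≡1+2k : ∣ S ∣ ≡ suc (k + k))
                 (G F : Subset m → ℚ)
                 (G≤ : ∀ {T x} → T ⊆ S → (∀ {z} → z ∈ S ─ T → z ≼ x) → G T ≤ v x)
                 (≤F : ∀ {T x} → T ⊆ S → ∣ T ∣ ≡ k → LowestAbove T (S ─ T) x → v x ≤ F T)
                 (F≥0 : ∀ T → 0ℚ ≤ F T) where

    -- R consists of the ∣ R ∣ largest elements of S, and x is the next one.
    record Peeled (b : ℕ) (R : Subset m) (x : Fin m) : Set where
      field
        size  : ∣ R ∣ + b ≡ k
        rest  : ∣ S ─ R ∣ ≡ suc (k + b)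
        R⊆S   : R ⊆ S
        above : ∀ {r z} → r ∈ R → z ∈ S ─ R → z ≺ r
        next  : IsTop (S ─ R) x

      x∈S : x ∈ S
      x∈S = p─q⊆p S R (proj₁ next)

      x∉R : x ∉ R
      x∉R = x∈p─q⇒x∉q S R (proj₁ next)

      ∣S─R-x∣≡ : ∣ S ─ R - x ∣ ≡ k + b
      ∣S─R-x∣≡ = ℕ.suc-injective (trans (1+∣p-x∣≡∣p∣ (proj₁ next)) rest)

    open Peeled

    ∣S─⊥∣≡1+2k : ∣ S ─ ⊥ ∣ ≡ suc (k + k)
    ∣S─⊥∣≡1+2k = trans (cong ∣_∣ (p─⊥≡p S)) ∣S∣≡1+2k

    start : ∃[ x ] Peeled k ⊥ x
    start with x , x-top ← top (S ─ ⊥) (subst (λ n → 0 ℕ.< n) (sym ∣S─⊥∣≡1+2k) ℕ.z<s) = x , record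
      { size  = cong (_+ k) (∣⊥∣≡0 m)
      ; rest  = ∣S─⊥∣≡1+2k
      ; R⊆S   = ⊥⊆
      ; above = λ r∈⊥ → contradiction r∈⊥ ∉⊥
      ; next  = x-top
      }

    successor : ∀ {b R x} → Peeled (suc b) R x → ∃ (IsTop (S ─ R - x))
    successor {b} P = top _ (subst (λ n → 0 ℕ.< n) (sym (∣S─R-x∣≡ P)) (ℕ.<-≤-trans ℕ.z<s (ℕ.m≤n+m (suc b) k)))

    peel : ∀ {b R x} → Peeled (suc b) R x → ∃[ y ] Peeled b (R ∪ ⁅ x ⁆) y × IsTop (S ─ R - x) y
    peel {b} {R} {x} P with y , y-top ← successor P =
      y , record
        { size  = trans (cong (_+ b) (∣p∪⁅x⁆∣≡1+∣p∣ (x∉R P))) (trans (sym (ℕ.+-suc ∣ R ∣ b)) (size P))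
        ; rest  = trans (cong ∣_∣ (sym S─R-x≡)) (trans (∣S─R-x∣≡ P) (ℕ.+-suc k b))
        ; R⊆S   = R∪x⊆S
        ; above = above′
        ; next  = subst (λ U → IsTop U y) S─R-x≡ y-top
        } , y-top
      where
      S─R-x≡ : S ─ R - x ≡ S ─ (R ∪ ⁅ x ⁆)
      S─R-x≡ = p─q─r≡p─q∪r S R ⁅ x ⁆
      R∪x⊆S : R ∪ ⁅ x ⁆ ⊆ S
      R∪x⊆S z∈ with x∈p∪q⁻ R ⁅ x ⁆ z∈
      ... | inj₁ z∈R = R⊆S P z∈R
      ... | inj₂ z∈x = x∈p⇒⁅x⁆⊆p (x∈S P) z∈x
      above′ : ∀ {r z} → r ∈ R ∪ ⁅ x ⁆ → z ∈ S ─ (R ∪ ⁅ x ⁆) → z ≺ r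
      above′ r∈ z∈ with z∈S─R , z≢x ← x∈p-y⁻ (subst (_ ∈_) (sym S─R-x≡) z∈) | x∈p∪q⁻ R ⁅ x ⁆ r∈
      ... | inj₁ r∈R = above P r∈R z∈S─R
      ... | inj₂ r∈x with refl ← x∈⁅y⁆⇒x≡y x r∈x | proj₂ (next P) z∈S─R
      ...   | inj₁ z≡x = contradiction z≡x z≢x
      ...   | inj₂ z≺x = z≺x

    G≤next : ∀ {b R x T} → Peeled b R x → R ⊆ T → T ⊆ S → G T ≤ v x
    G≤next P R⊆T T⊆S = G≤ T⊆S λ z∈S─T →
      let z∈S , z∉T = Equivalence.to x∈p─q⇔ z∈S─T in proj₂ (next P) (x∈p∧x∉q⇒x∈p─q z∈S (z∉T ∘ R⊆T))

    next≤F : ∀ {b R x T} → Peeled b R x → T ⊆ S ─ R - x → ∣ T ∣ ≡ k →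
             (∀ {z} → z ∈ S ─ R - x → z ∉ T → ∃[ t ] t ∈ T × z ≺ t) → v x ≤ F T
    next≤F {R = R} {x} {T} P T⊆ ∣T∣≡k dominated = ≤F (p─q⊆p S R ∘ T⊆S─R) ∣T∣≡k (x∈S─T , T≺x , lowest)
      where
      T⊆S─R : T ⊆ S ─ R
      T⊆S─R = proj₁ ∘ x∈p-y⁻ ∘ T⊆
      x∉T : x ∉ T
      x∉T x∈T = proj₂ (x∈p-y⁻ (T⊆ x∈T)) refl
      x∈S─T : x ∈ S ─ T
      x∈S─T = x∈p∧x∉q⇒x∈p─q (x∈S P) x∉T
      T≺x : ∀ {t} → t ∈ T → t ≺ x
      T≺x t∈T with proj₂ (next P) (T⊆S─R t∈T)
      ... | inj₁ refl = contradiction t∈T x∉T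
      ... | inj₂ t≺x  = t≺x
      lowest : ∀ {z} → z ∈ S ─ T → z ≺ x → ∃[ t ] t ∈ T × z ≺ t
      lowest z∈S─T z≺x with z∈S , z∉T ← Equivalence.to x∈p─q⇔ z∈S─T =
        dominated (x∈p∧x≢y⇒x∈p-y (x∈p∧x∉q⇒x∈p─q z∈S z∉R) z≢x) z∉T
        where
        z∉R = λ z∈R → ≺-asym z≺x (above P z∈R (proj₁ (next P)))
        z≢x = λ { refl → ≺-asym z≺x z≺x }

    ∑G-excluding-next : ∀ {b R x} → Peeled b R x → ∑ (subsetsBetween k R (S - x)) G ≤ binom b k · v x
    ∑G-excluding-next {b} {R} {x} P = ℚ.≤-trans (∑-≤-· _ bound) (ℚ.≤-reflexive (cong (_· v x) count))
      where
      R⊆S-x : R ⊆ S - x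
      R⊆S-x r∈R = x∈p∧x≢y⇒x∈p-y (R⊆S P r∈R) (λ { refl → x∉R P r∈R })
      ∣S-x∣≡ : ∣ S - x ∣ ≡ ∣ R ∣ + (b + k)
      ∣S-x∣≡ = ℕ.suc-injective (begin
        suc ∣ S - x ∣          ≡⟨ 1+∣p-x∣≡∣p∣ (x∈S P) ⟩
        ∣ S ∣                  ≡⟨ ∣S∣≡1+2k ⟩
        suc (k + k)            ≡⟨ cong (λ n → suc (n + k)) (size P) ⟨
        suc (∣ R ∣ + b + k)    ≡⟨ cong suc (ℕ.+-assoc ∣ R ∣ b k) ⟩
        suc (∣ R ∣ + (b + k))  ∎)
        where open ≡-Reasoning
      count : length (subsetsBetween k R (S - x)) ≡ binom b k
      count = subst (λ K → length (subsetsBetween K R (S - x)) ≡ binom b k) (size P)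
                    (length-subsetsBetween b k R⊆S-x ∣S-x∣≡)
      bound : ∀ {T} → T ∈ˡ subsetsBetween k R (S - x) → G T ≤ v x
      bound T∈ with R⊆T , T⊆S-x , _ ← ∈-subsetsBetween⁻ T∈ = G≤next P R⊆T (proj₁ ∘ x∈p-y⁻ ∘ T⊆S-x)

    ∑F-including-successor : ∀ {b R x y} → Peeled (suc b) R x → IsTop (S ─ R - x) y →
                             binom (∣ R ∣ + b) (suc b) · v x ≤ ∑ (subsetsBetween k ⁅ y ⁆ (S ─ R - x)) F
    ∑F-including-successor {b} {R} {x} {y} P (y∈ , ≼y) =
      ℚ.≤-trans (ℚ.≤-reflexive (cong (_· v x) (sym count))) (·-≤-∑ _ bound)
      where
      1+k′≡k : suc (∣ R ∣ + b) ≡ k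
      1+k′≡k = trans (sym (ℕ.+-suc ∣ R ∣ b)) (size P)
      ∣⁅y⁆∣+k′≡k : ∣ ⁅ y ⁆ ∣ + (∣ R ∣ + b) ≡ k
      ∣⁅y⁆∣+k′≡k = trans (cong (_+ (∣ R ∣ + b)) (∣⁅x⁆∣≡1 y)) 1+k′≡k
      ∣S─R-x∣≡′ : ∣ S ─ R - x ∣ ≡ ∣ ⁅ y ⁆ ∣ + (∣ R ∣ + b + suc b)
      ∣S─R-x∣≡′ = trans (∣S─R-x∣≡ P)
                        (trans (cong (_+ suc b) (sym ∣⁅y⁆∣+k′≡k)) (ℕ.+-assoc ∣ ⁅ y ⁆ ∣ (∣ R ∣ + b) (suc b)))
      count : length (subsetsBetween k ⁅ y ⁆ (S ─ R - x)) ≡ binom (∣ R ∣ + b) (suc b)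
      count = subst (λ K → length (subsetsBetween K ⁅ y ⁆ (S ─ R - x)) ≡ binom (∣ R ∣ + b) (suc b))
                    ∣⁅y⁆∣+k′≡k (length-subsetsBetween (∣ R ∣ + b) (suc b) (x∈p⇒⁅x⁆⊆p y∈) ∣S─R-x∣≡′)
      bound : ∀ {T} → T ∈ˡ subsetsBetween k ⁅ y ⁆ (S ─ R - x) → v x ≤ F T
      bound {T} T∈ with y⊆T , T⊆ , ∣T∣≡k ← ∈-subsetsBetween⁻ T∈ = next≤F P T⊆ ∣T∣≡k dominated
        where
        dominated : ∀ {z} → z ∈ S ─ R - x → z ∉ T → ∃[ t ] t ∈ T × z ≺ t
        dominated z∈ z∉T with ≼y z∈
        ... | inj₁ refl = contradiction (y⊆T (x∈⁅x⁆ y)) z∉T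
        ... | inj₂ z≺y  = y , y⊆T (x∈⁅x⁆ y) , z≺y

    ∑G-of-supersets : ∀ {R x} → Peeled 0 R x → ∑ (subsetsBetween k R S) G ≤ 1 · v x
    ∑G-of-supersets {R} {x} P = ℚ.≤-trans (∑-≤-· _ bound) (ℚ.≤-reflexive (cong (_· v x) count))
      where
      ∣S∣≡ : ∣ S ∣ ≡ ∣ R ∣ + (0 + suc k)
      ∣S∣≡ = trans ∣S∣≡1+2k (trans (sym (ℕ.+-suc k k))
                                  (cong (_+ suc k) (sym (trans (sym (ℕ.+-identityʳ ∣ R ∣)) (size P)))))
      count : length (subsetsBetween k R S) ≡ 1
      count = subst (λ K → length (subsetsBetween K R S) ≡ 1) (size P)
                    (length-subsetsBetween 0 (suc k) (R⊆S P) ∣S∣≡)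
      bound : ∀ {T} → T ∈ˡ subsetsBetween k R S → G T ≤ v x
      bound T∈ with R⊆T , T⊆S , _ ← ∈-subsetsBetween⁻ T∈ = G≤next P R⊆T T⊆S

    ∑F-of-complement : ∀ {R x} → Peeled 0 R x → 1 · v x ≤ ∑ (subsetsBetween k ⊥ (S ─ R - x)) F
    ∑F-of-complement {R} {x} P = ℚ.≤-trans (ℚ.≤-reflexive (cong (_· v x) (sym count))) (·-≤-∑ _ bound)
      where
      ∣U∣≡ : ∣ S ─ R - x ∣ ≡ ∣ ⊥ {n = m} ∣ + (k + 0)
      ∣U∣≡ = trans (∣S─R-x∣≡ P) (cong (_+ (k + 0)) (sym (∣⊥∣≡0 m)))
      count : length (subsetsBetween k ⊥ (S ─ R - x)) ≡ 1
      count = subst (λ K → length (subsetsBetween K ⊥ (S ─ R - x)) ≡ 1) (cong (_+ k) (∣⊥∣≡0 m))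
                    (trans (length-subsetsBetween {L = ⊥} {U = S ─ R - x} k 0 ⊥⊆ ∣U∣≡) (binom-zeroʳ k))
      bound : ∀ {T} → T ∈ˡ subsetsBetween k ⊥ (S ─ R - x) → v x ≤ F T
      bound T∈ with _ , T⊆U , ∣T∣≡k ← ∈-subsetsBetween⁻ T∈ =
        next≤F P T⊆U ∣T∣≡k (λ z∈U z∉T → contradiction (U⊆T z∈U) z∉T)
        where
        U⊆T = p⊆q∧∣q∣≤∣p∣⇒q⊆p T⊆U (ℕ.≤-reflexive (trans (∣S─R-x∣≡ P) (trans (ℕ.+-identityʳ k) (sym ∣T∣≡k))))

    peeling-from : ∀ b {R x} → Peeled b R x →
                   ½ * ∑ (subsetsBetween k R S) G ≤ ∑ (subsetsBetween k ⊥ (S ─ R - x)) F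
    peeling-from zero {R} {x} P = begin
      ½ * ∑ (subsetsBetween k R S) G        ≤⟨ ℚ.*-monoˡ-≤-nonNeg ½ (∑G-of-supersets P) ⟩
      ½ * (1 · v x)                         ≤⟨ ½*·-≤ 1 1 (ℕ.s≤s ℕ.z≤n) (v≥0 x) ⟩
      1 · v x                               ≤⟨ ∑F-of-complement P ⟩
      ∑ (subsetsBetween k ⊥ (S ─ R - x)) F  ∎
      where open ℚ.≤-Reasoning
    peeling-from (suc b) {R} {x} P with y , P′ , y-top ← peel P = begin
      ½ * ∑ (subsetsBetween k R S) G
        ≡⟨ cong (½ *_) (∑-subsetsBetween-split k R S x G) ⟩
      ½ * (∑ (subsetsBetween k R (S - x)) G +ℚ ∑ (subsetsBetween k (R ∪ ⁅ x ⁆) S) G)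
        ≡⟨ ℚ.*-distribˡ-+ ½ (∑ (subsetsBetween k R (S - x)) G) _ ⟩
      ½ * ∑ (subsetsBetween k R (S - x)) G +ℚ ½ * ∑ (subsetsBetween k (R ∪ ⁅ x ⁆) S) G
        ≤⟨ ℚ.+-mono-≤ half-excluding (peeling-from b P′) ⟩
      binom k′ (suc b) · v x +ℚ ∑ (subsetsBetween k ⊥ (S ─ (R ∪ ⁅ x ⁆) - y)) F
        ≡⟨ cong (λ U → binom k′ (suc b) · v x +ℚ ∑ (subsetsBetween k ⊥ (U - y)) F) (p─q─r≡p─q∪r S R ⁅ x ⁆) ⟨
      binom k′ (suc b) · v x +ℚ ∑ (subsetsBetween k ⊥ (S ─ R - x - y)) F
        ≤⟨ ℚ.+-monoˡ-≤ _ (∑F-including-successor P y-top) ⟩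
      ∑ (subsetsBetween k ⁅ y ⁆ (S ─ R - x)) F +ℚ ∑ (subsetsBetween k ⊥ (S ─ R - x - y)) F
        ≡⟨ ℚ.+-comm (∑ (subsetsBetween k ⁅ y ⁆ (S ─ R - x)) F) _ ⟩
      ∑ (subsetsBetween k ⊥ (S ─ R - x - y)) F +ℚ ∑ (subsetsBetween k ⁅ y ⁆ (S ─ R - x)) F
        ≡⟨ cong (λ L → ∑ (subsetsBetween k ⊥ (S ─ R - x - y)) F +ℚ ∑ (subsetsBetween k L (S ─ R - x)) F)
                (∪-identityˡ ⁅ y ⁆) ⟨
      ∑ (subsetsBetween k ⊥ (S ─ R - x - y)) F +ℚ ∑ (subsetsBetween k (⊥ ∪ ⁅ y ⁆) (S ─ R - x)) F
        ≡⟨ ∑-subsetsBetween-split k ⊥ (S ─ R - x) y F ⟨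
      ∑ (subsetsBetween k ⊥ (S ─ R - x)) F  ∎
      where
      open ℚ.≤-Reasoning
      k′ = ∣ R ∣ + b
      1+k′≡k : suc k′ ≡ k
      1+k′≡k = trans (sym (ℕ.+-suc ∣ R ∣ b)) (size P)
      half-excluding : ½ * ∑ (subsetsBetween k R (S - x)) G ≤ binom k′ (suc b) · v x
      half-excluding = ℚ.≤-trans (ℚ.*-monoˡ-≤-nonNeg ½ (∑G-excluding-next P))
        (½*·-≤ (binom (suc b) k) (binom k′ (suc b))
               (subst (λ K → binom (suc b) K ℕ.≤ binom k′ (suc b) + binom k′ (suc b)) 1+k′≡k
                      (binom-≤-double (ℕ.m≤n+m b ∣ R ∣)))
               (v≥0 x))

    peeling : ½ * ∑ (subsetsOfSize k S) G ≤ ∑ (subsetsOfSize k S) F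
    peeling with x , P ← start = begin
      ½ * ∑ (subsetsOfSize k S) G
        ≡⟨ cong (λ Ts → ½ * ∑ Ts G) (subsetsOfSize≡subsetsBetween k S) ⟩
      ½ * ∑ (subsetsBetween k ⊥ S) G
        ≤⟨ peeling-from k P ⟩
      ∑ (subsetsBetween k ⊥ (S ─ ⊥ - x)) F
        ≡⟨ cong (λ U → ∑ (subsetsBetween k ⊥ (U - x)) F) (p─⊥≡p S) ⟩
      ∑ (subsetsBetween k ⊥ (S - x)) F
        ≤⟨ p≤p+q (∑ (subsetsBetween k ⊥ (S - x)) F) (∑-nonneg (subsetsBetween k (⊥ ∪ ⁅ x ⁆) S) F≥0) ⟩
      ∑ (subsetsBetween k ⊥ (S - x)) F +ℚ ∑ (subsetsBetween k (⊥ ∪ ⁅ x ⁆) S) F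
        ≡⟨ ∑-subsetsBetween-split k ⊥ S x F ⟨
      ∑ (subsetsBetween k ⊥ S) F
        ≡⟨ cong (λ Ts → ∑ Ts F) (subsetsOfSize≡subsetsBetween k S) ⟨
      ∑ (subsetsOfSize k S) F  ∎
      where open ℚ.≤-Reasoning

module _ (k h : ℕ) where

  private
    N = suc k + h

  size-swap : ∀ {S T : Subset N} → T ⊆ S → ∣ T ∣ ≡ k → ∣ compl (S ⊕ T) ∣ ≡ h ⇔ ∣ S ∣ ≡ suc (k + k)
  size-swap {S} {T} T⊆S ∣T∣≡k = mk⇔ to from
    where
    ∣S─T∣+k≡∣S∣ : ∣ S ─ T ∣ + k ≡ ∣ S ∣
    ∣S─T∣+k≡∣S∣ = trans (cong (λ n → ∣ S ─ T ∣ + n) (sym ∣T∣≡k)) (∣p─q∣+∣q∣≡∣p∣ T⊆S)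
    ∣H∣+∣S─T∣≡h+1+k : ∣ compl (S ⊕ T) ∣ + ∣ S ─ T ∣ ≡ h + suc k
    ∣H∣+∣S─T∣≡h+1+k = trans (cong (λ O → ∣ compl (S ⊕ T) ∣ + ∣ O ∣) (sym (p⊕q≡p─q T⊆S)))
                            (trans (∣compl-p∣+∣p∣≡n (S ⊕ T)) (ℕ.+-comm (suc k) h))
    to : ∣ compl (S ⊕ T) ∣ ≡ h → ∣ S ∣ ≡ suc (k + k)
    to ∣H∣≡h = trans (sym ∣S─T∣+k≡∣S∣) (cong (_+ k) ∣S─T∣≡1+k)
      where
      ∣S─T∣≡1+k : ∣ S ─ T ∣ ≡ suc k
      ∣S─T∣≡1+k = ℕ.+-cancelˡ-≡ h _ _ (trans (cong (_+ ∣ S ─ T ∣) (sym ∣H∣≡h)) ∣H∣+∣S─T∣≡h+1+k)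
    from : ∣ S ∣ ≡ suc (k + k) → ∣ compl (S ⊕ T) ∣ ≡ h
    from ∣S∣≡ = ℕ.+-cancelʳ-≡ (suc k) _ _ (trans (cong (λ n → ∣ compl (S ⊕ T) ∣ + n) (sym ∣S─T∣≡1+k))
                                                 ∣H∣+∣S─T∣≡h+1+k)
      where
      ∣S─T∣≡1+k : ∣ S ─ T ∣ ≡ suc k
      ∣S─T∣≡1+k = ℕ.+-cancelʳ-≡ k _ _ (trans ∣S─T∣+k≡∣S∣ ∣S∣≡)

  -- For fixed T the substitution H = compl (S ⊕ T) is a bijection of the subsets; when T ⊆ H it
  -- makes S = O ∪ T, where O = compl H is the online set.
  reindex : ∀ (Φ : Subset N → Subset N → ℚ) →
            ∑[ H ← subsetsOfSize h (full N) ] ∑[ T ← subsetsOfSize k H ] Φ T H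
            ≡ ∑[ S ← subsetsOfSize (suc (k + k)) (full N) ] ∑[ T ← subsetsOfSize k S ] Φ T (compl (S ⊕ T))
  reindex Φ = begin
    ∑[ H ← subsetsOfSize h (full N) ] ∑[ T ← subsetsOfSize k H ] Φ T H
      ≡⟨ ∑-filter-∑-filter (sized? h) (λ _ → sized? k) (allSubsets N) (allSubsets N) (λ H T → Φ T H) ⟩
    ∑[ H ← allSubsets N ] ∑[ T ← allSubsets N ] ⟦ drawn h H T ⟧ Φ T H
      ≡⟨ ∑-swap (allSubsets N) (allSubsets N) _ ⟩
    ∑[ T ← allSubsets N ] ∑[ H ← allSubsets N ] ⟦ drawn h H T ⟧ Φ T H
      ≡⟨ ∑-cong (allSubsets N) (λ {T} _ → sym (∑-allSubsets-compl-⊕ T (λ H → ⟦ drawn h H T ⟧ Φ T H))) ⟩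
    ∑[ T ← allSubsets N ] ∑[ S ← allSubsets N ] ⟦ drawn h (compl (S ⊕ T)) T ⟧ Φ T (compl (S ⊕ T))
      ≡⟨ ∑-cong (allSubsets N) (λ {T} _ → ∑-cong (allSubsets N) (λ {S} _ →
           cong (λ b → ⟦ b ⟧ Φ T (compl (S ⊕ T))) (drawn-swap S T))) ⟩
    ∑[ T ← allSubsets N ] ∑[ S ← allSubsets N ] ⟦ drawn (suc (k + k)) S T ⟧ Φ T (compl (S ⊕ T))
      ≡⟨ ∑-swap (allSubsets N) (allSubsets N) _ ⟩
    ∑[ S ← allSubsets N ] ∑[ T ← allSubsets N ] ⟦ drawn (suc (k + k)) S T ⟧ Φ T (compl (S ⊕ T))
      ≡⟨ ∑-filter-∑-filter (sized? (suc (k + k))) (λ _ → sized? k) (allSubsets N) (allSubsets N)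
                           (λ S T → Φ T (compl (S ⊕ T))) ⟨
    ∑[ S ← subsetsOfSize (suc (k + k)) (full N) ] ∑[ T ← subsetsOfSize k S ] Φ T (compl (S ⊕ T))  ∎
    where
    open ≡-Reasoning
    sized? : ∀ j {U : Subset N} → Decidable (λ T → ∣ T ∣ ≡ j × T ⊆ U)
    sized? j {U} T = ∣ T ∣ ℕ.≟ j ×-dec T ⊆? U
    ⟦_⟧_ : Bool → ℚ → ℚ
    ⟦ b ⟧ q = if b then q else 0ℚ
    drawn : ℕ → Subset N → Subset N → Bool
    drawn j U T = does (sized? j {full N} U) ∧ does (sized? k {U} T)
    drawn-swap : ∀ S T → drawn h (compl (S ⊕ T)) T ≡ drawn (suc (k + k)) S T
    drawn-swap S T = does-⇔ (mk⇔ to from) (sized? h (compl (S ⊕ T)) ×-dec sized? k T)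
                                          (sized? (suc (k + k)) S ×-dec sized? k T)
      where
      to : (∣ compl (S ⊕ T) ∣ ≡ h × compl (S ⊕ T) ⊆ full N) × (∣ T ∣ ≡ k × T ⊆ compl (S ⊕ T)) →
           (∣ S ∣ ≡ suc (k + k) × S ⊆ full N) × (∣ T ∣ ≡ k × T ⊆ S)
      to ((∣H∣≡h , _) , (∣T∣≡k , T⊆H)) with T⊆S ← Equivalence.to q⊆compl[p⊕q]⇔q⊆p T⊆H =
        (Equivalence.to (size-swap T⊆S ∣T∣≡k) ∣H∣≡h , p⊆full S) , (∣T∣≡k , T⊆S)
      from : (∣ S ∣ ≡ suc (k + k) × S ⊆ full N) × (∣ T ∣ ≡ k × T ⊆ S) →
             (∣ compl (S ⊕ T) ∣ ≡ h × compl (S ⊕ T) ⊆ full N) × (∣ T ∣ ≡ k × T ⊆ compl (S ⊕ T))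
      from ((∣S∣≡ , _) , (∣T∣≡k , T⊆S)) =
        (Equivalence.from (size-swap T⊆S ∣T∣≡k) ∣S∣≡ , p⊆full _) ,
        (∣T∣≡k , Equivalence.from q⊆compl[p⊕q]⇔q⊆p T⊆S)

module Algorithm2 {k h : ℕ} (v : Fin (suc k + h) → ℚ) (v≥0 : ∀ i → 0ℚ ≤ v i)
                  (σ : Subset (suc k + h) → List (Fin (suc k + h)))
                  (σ-perm : ∀ H → ∣ H ∣ ≡ h → σ H ↭ members (compl H)) where

  open Candidates v

  opt : Subset (suc k + h) → ℚ
  opt H = maxVal v (members (compl H))

  ½opt≤alg-for : ∀ {S} → ∣ S ∣ ≡ suc (k + k) →
                 ∑[ T ← subsetsOfSize k S ] ½ * opt (compl (S ⊕ T))
                 ≤ ∑[ T ← subsetsOfSize k S ] alg2 v T (σ (compl (S ⊕ T)))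
  ½opt≤alg-for {S} ∣S∣≡ = begin
    ∑[ T ← subsetsOfSize k S ] ½ * opt (compl (S ⊕ T))
      ≡⟨ ∑-cong (subsetsOfSize k S) (λ {T} _ →
           cong (λ X → ½ * maxVal v (members X)) (compl-involutive (S ⊕ T))) ⟩
    ∑[ T ← subsetsOfSize k S ] ½ * maxVal v (members (S ⊕ T))
      ≡⟨ ∑-*ˡ (subsetsOfSize k S) ½ _ ⟩
    ½ * (∑[ T ← subsetsOfSize k S ] maxVal v (members (S ⊕ T)))
      ≤⟨ Peeling.peeling v≥0 k S ∣S∣≡ _ _ opt≤ ≤alg (λ T → alg2-nonneg v≥0 T (σ (compl (S ⊕ T)))) ⟩
    ∑[ T ← subsetsOfSize k S ] alg2 v T (σ (compl (S ⊕ T)))  ∎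
    where
    open ℚ.≤-Reasoning
    opt≤ : ∀ {T x} → T ⊆ S → (∀ {z} → z ∈ S ─ T → z ≼ x) → maxVal v (members (S ⊕ T)) ≤ v x
    opt≤ {T} {x} T⊆S S─T≼x = maxVal-≤ (members (S ⊕ T)) (v≥0 x)
      (λ z∈ → ≼⇒≤ (S─T≼x (subst (_ ∈_) (p⊕q≡p─q T⊆S) (∈-members⁻ z∈))))
    ≤alg : ∀ {T x} → T ⊆ S → ∣ T ∣ ≡ k → LowestAbove T (S ─ T) x → v x ≤ alg2 v T (σ (compl (S ⊕ T)))
    ≤alg {T} {x} T⊆S ∣T∣≡k lowest =
      alg2-≥-lowestAbove (σ H) σH↭ (subst (λ O → LowestAbove T O x) (sym (p⊕q≡p─q T⊆S)) lowest)
      where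
      H = compl (S ⊕ T)
      σH↭ : σ H ↭ members (S ⊕ T)
      σH↭ = subst (λ X → σ H ↭ members X) (compl-involutive (S ⊕ T))
                  (σ-perm H (Equivalence.from (size-swap k h T⊆S ∣T∣≡k) ∣S∣≡))

  ½opt≤alg : ∑[ H ← subsetsOfSize h (full (suc k + h)) ] ∑[ T ← subsetsOfSize k H ] ½ * opt H
             ≤ ∑[ H ← subsetsOfSize h (full (suc k + h)) ] ∑[ T ← subsetsOfSize k H ] alg2 v T (σ H)
  ½opt≤alg = begin
    ∑[ H ← subsetsOfSize h (full (suc k + h)) ] ∑[ T ← subsetsOfSize k H ] ½ * opt H
      ≡⟨ reindex k h (λ T H → ½ * opt H) ⟩
    ∑[ S ← Ss ] ∑[ T ← subsetsOfSize k S ] ½ * opt (compl (S ⊕ T))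
      ≤⟨ ∑-mono Ss (½opt≤alg-for ∘ ∈-subsetsOfSize⁻) ⟩
    ∑[ S ← Ss ] ∑[ T ← subsetsOfSize k S ] alg2 v T (σ (compl (S ⊕ T)))
      ≡⟨ reindex k h (λ T H → alg2 v T (σ H)) ⟨
    ∑[ H ← subsetsOfSize h (full (suc k + h)) ] ∑[ T ← subsetsOfSize k H ] alg2 v T (σ H)  ∎
    where
    open ℚ.≤-Reasoning
    Ss = subsetsOfSize (suc (k + k)) (full (suc k + h))

theorem3 : (n h : ℕ) → 1 Data.Nat.≤ n → n Data.Nat.≤ h →
           (v : Fin (n + h) → ℚ) → (∀ i → 0ℚ ≤ v i) →
           (σ : Subset (n + h) → List (Fin (n + h))) →
           (∀ H → ∣ H ∣ ≡ h → σ H ↭ members (compl H)) →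
           ((+ 1) / 2) * expOPT n h v ≤ expALG n h v σ
theorem3 zero    _ ()
theorem3 (suc k) h _ n≤h v v≥0 σ σ-perm with M , uniform ← subsetsOfSize-uniform k h (ℕ.<⇒≤ n≤h) = begin
  ½ * expOPT (suc k) h v           ≡⟨ mean-*ˡ ½ opt Hs ⟩
  mean (map (λ H → ½ * opt H) Hs)  ≤⟨ mean-of-means-mono M (subsetsOfSize k) Hs (λ H → ½ * opt H)
                                        (λ H T → alg2 v T (σ H)) (λ {H} → uniform {H} ∘ ∈-subsetsOfSize⁻)
                                        ½opt≤alg ⟩
  expALG (suc k) h v σ             ∎
  where
  open ℚ.≤-Reasoning
  open Algorithm2 v v≥0 σ σ-perm
  Hs = subsetsOfSize h (full (suc k + h))
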